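{- Let $q$ be a prime power and $n,l,m$ integers with $1<m<n-1$, $l>0$. Let $W$ be an $(m-1)$-dimensional subspace of $\mathbb{F}_q^{(n+l)}$ with $W\cap E=0$. Then the subgraph $C(W)$ of $\Gamma^{(m)}$ induced on the set of all vertices containing $W$ is isomorphic to the complete multipartite graph $K_{{n-m+1\brack 1}}(q^l)$, i.e. with ${n-m+1\brack 1}$ parts each of size $q^l$.
   Context: Let $\mathbb{F}_q^{(n+l)}$ be the row vector space over $\mathbb{F}_q$ with standard basis $e_1,\dots,e_{n+l}$ and $E=\langle e_{n+1},\dots,e_{n+l}\rangle$. Let $X_m$ be the set of $m$-dimensional subspaces $P$ with $P\cap E=0$. For a subspace $P$ given by a matrix $(P'\ P'')$ whose rows span $P$, where $P'$ consists of the first $n$ columns and $P''$ the last $l$ columns, $P'$ also denotes the subspace of $\mathbb{F}_q^{(n)}$ spanned by the rows of $P'$. The graph $\Gamma^{(m)}$ has vertex set $X_m$, with $P,Q$ adjacent iff $\dim(P'\cap Q')=m-1$ and $\dim(P\cap Q)=m-1$. ${a\brack 1}=(q^a-1)/(q-1)$. -}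

module Defs where

open import Level using (Level; _⊔_)
open import Data.Nat as ℕ using (ℕ; zero; suc; _^_; _<_; _∸_)
open import Data.Nat.Primality using (Prime)
open import Data.Fin as Fin using (Fin; suc; _↑ˡ_)
open import Data.Product using (Σ; ∃; _×_; _,_; proj₁)
open import Relation.Binary.PropositionalEquality using (_≡_)
open import Relation.Nullary using (¬_)
open import Algebra.Bundles using (CommutativeRing)

IsPrimePower : ℕ → Set
IsPrimePower q = Σ ℕ λ p → Σ ℕ λ k → Prime p × q ≡ p ^ suc k

-- Gaussian coefficient [a brack 1] = (q^a - 1)/(q - 1) = 1 + q + ... + q^(a-1)
gauss1 : ℕ → ℕ → ℕ
gauss1 q zero    = 0
gauss1 q (suc a) = q ^ a ℕ.+ gauss1 q a

record IsField {c ℓ : Level} (R : CommutativeRing c ℓ) : Set (c ⊔ ℓ) where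
  open CommutativeRing R
  field
    0≉1 : ¬ (0# ≈ 1#)
    inverse : ∀ x → ¬ (x ≈ 0#) → ∃ λ y → (x * y) ≈ 1#

record HasCard {c ℓ : Level} (R : CommutativeRing c ℓ) (q : ℕ) : Set (c ⊔ ℓ) where
  open CommutativeRing R
  field
    enum : Fin q → Carrier
    enum-surj : ∀ x → ∃ λ i → enum i ≈ x
    enum-inj : ∀ i j → enum i ≈ enum j → i ≡ j

KVertex : ℕ → ℕ → Set
KVertex a b = Fin a × Fin b

KAdj : ∀ {a b} → KVertex a b → KVertex a b → Set
KAdj u v = ¬ (proj₁ u ≡ proj₁ v)

record IsoToK {v e : Level} (V : Set v) (_~_ : V → V → Set e) (Adj : V → V → Set e)
              (a b : ℕ) : Set (v ⊔ e) where
  field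
    f : V → KVertex a b
    f-resp : ∀ x y → x ~ y → f x ≡ f y
    f-inj : ∀ x y → f x ≡ f y → x ~ y
    f-surj : ∀ t → ∃ λ x → f x ≡ t
    adj→ : ∀ x y → Adj x y → KAdj (f x) (f y)
    adj← : ∀ x y → KAdj (f x) (f y) → Adj x y

module LinAlg {c ℓ : Level} (R : CommutativeRing c ℓ) where
  open CommutativeRing R using (Carrier; _≈_; _+_; _*_; 0#)

  Vecᶠ : ℕ → Set c
  Vecᶠ k = Fin k → Carrier

  Mat : ℕ → ℕ → Set c
  Mat r k = Fin r → Vecᶠ k

  sumF : ∀ {r} → (Fin r → Carrier) → Carrier
  sumF {ℕ.zero}  g = 0#
  sumF {suc r} g = g Fin.zero + sumF (λ i → g (suc i))

  _≈ᵛ_ : ∀ {k} → Vecᶠ k → Vecᶠ k → Set ℓ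
  u ≈ᵛ w = ∀ j → u j ≈ w j

  0ᵛ : ∀ {k} → Vecᶠ k
  0ᵛ j = 0#

  lincomb : ∀ {r k} → (Fin r → Carrier) → Mat r k → Vecᶠ k
  lincomb cs A j = sumF (λ i → cs i * A i j)

  _∈span_ : ∀ {r k} → Vecᶠ k → Mat r k → Set (c ⊔ ℓ)
  v ∈span A = ∃ λ cs → v ≈ᵛ lincomb cs A

  Independent : ∀ {r k} → Mat r k → Set (c ⊔ ℓ)
  Independent A = ∀ cs → lincomb cs A ≈ᵛ 0ᵛ → ∀ i → cs i ≈ 0#

  HasDim : ∀ {k} → (Vecᶠ k → Set (c ⊔ ℓ)) → ℕ → Set (c ⊔ ℓ)
  HasDim {k} S d = Σ (Mat d k) λ B → Independent B ×
                     (∀ v → (v ∈span B → S v) × (S v → v ∈span B))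

  SameSpan : ∀ {r s k} → Mat r k → Mat s k → Set (c ⊔ ℓ)
  SameSpan A B = ∀ v → (v ∈span A → v ∈span B) × (v ∈span B → v ∈span A)

  module Ambient (n l : ℕ) where
    firstCols : ∀ {r} → Mat r (n ℕ.+ l) → Mat r n
    firstCols A i j = A i (j ↑ˡ l)

    -- v ∈ E = ⟨e_{n+1},...,e_{n+l}⟩ : first n coordinates vanish
    InE : Vecᶠ (n ℕ.+ l) → Set ℓ
    InE v = ∀ j → v (j ↑ˡ l) ≈ 0#

    MeetsETrivially : ∀ {r} → Mat r (n ℕ.+ l) → Set (c ⊔ ℓ)
    MeetsETrivially A = ∀ v → v ∈span A → InE v → v ≈ᵛ 0ᵛ

    -- X_m : m-dimensional subspaces (given by a basis of m rows) meeting E trivially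
    X : ℕ → Set (c ⊔ ℓ)
    X m = Σ (Mat m (n ℕ.+ l)) λ A → Independent A × MeetsETrivially A

    SameVertex : ∀ {m} → X m → X m → Set (c ⊔ ℓ)
    SameVertex P Q = SameSpan (proj₁ P) (proj₁ Q)

    Adj : ∀ {m} → X m → X m → Set (c ⊔ ℓ)
    Adj {m} P Q =
      HasDim (λ v → (v ∈span firstCols (proj₁ P)) × (v ∈span firstCols (proj₁ Q))) (m ∸ 1)
      × HasDim (λ v → (v ∈span proj₁ P) × (v ∈span proj₁ Q)) (m ∸ 1)

    CV : ∀ {m w} → Mat w (n ℕ.+ l) → Set (c ⊔ ℓ)
    CV {m} W = Σ (X m) λ P → ∀ v → v ∈span W → v ∈span proj₁ P

    CSame : ∀ {m w} {W : Mat w (n ℕ.+ l)} → CV {m} W → CV {m} W → Set (c ⊔ ℓ)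
    CSame P Q = SameVertex (proj₁ P) (proj₁ Q)

    CAdj : ∀ {m w} {W : Mat w (n ℕ.+ l)} → CV {m} W → CV {m} W → Set (c ⊔ ℓ)
    CAdj P Q = Adj (proj₁ P) (proj₁ Q)

-- Write r = m - 1.  A vertex P ⊇ W is W + ⟨x⟩ for one further vector x.
-- Gaussian elimination of the first n columns of W (possible because
-- W ∩ E = 0) yields a linear projection `red` with kernel span W which
-- kills r "pivot" coordinates among the first n and fixes every vector
-- vanishing there.  On P it maps onto the line ⟨red x⟩, whose first n
-- coordinates are not all zero because P ∩ E = 0.  So P is determined by
--   (1) the projective point of (red x)′ in the n - r free coordinates,
--       one of gauss1 q (n - r) values, and
--   (2) the last l coordinates of red x, scaled so (red x)′ has leading
--       entry 1: one of q ^ l values,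
-- and every such pair occurs.  Two vertices with the same point (1) have
-- P′ = Q′ of dimension m; two with different points meet exactly in W
-- (and their first parts exactly in W′), of dimension m - 1.  Hence P ↦
-- (1),(2) is an isomorphism onto K_{gauss1 q (n-r)}(q ^ l).
module Submission where

open import Level using (Level; _⊔_; Lift; lower)
open import Algebra.Bundles using (CommutativeRing)
open import Data.Bool using (Bool; true; false; if_then_else_)
open import Data.Empty using (⊥; ⊥-elim)
open import Data.Fin as Fin using (Fin; zero; suc; punchIn; _↑ˡ_; _↑ʳ_; combine)
import Data.Fin.Properties as FinP
import Data.Integer as ℤ
import Data.Integer.Properties as ℤP
open import Data.Maybe using (Maybe; just; nothing)
open import Data.Nat using (ℕ; zero; suc; z≤n; s≤s; _<_; _∸_; _^_)
import Data.Nat as ℕ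
import Data.Nat.Properties as ℕP
open import Data.Product using (Σ; ∃; _×_; _,_; proj₁; proj₂)
open import Data.Sign as Sign using (Sign)
open import Data.Sum using (_⊎_; inj₁; inj₂; [_,_]′)
open import Data.Vec.Functional using (insertAt)
open import Data.Vec.Functional.Properties using (insertAt-lookup; insertAt-punchIn)
open import Relation.Binary.Definitions using (Decidable)
open import Relation.Binary.PropositionalEquality as P using (_≡_)
open import Relation.Nullary using (¬_; Dec; yes; no)
open import Relation.Nullary.Decidable using (map′)
open import Algebra.Solver.Ring.AlmostCommutativeRing as ACR using (_-Raw-AlmostCommutative⟶_)
open import Defs

-- The canonical map ℤ → R into any commutative ring is a ring morphism.
-- This is exactly what Algebra.Solver.Ring needs to normalise polynomial
-- identities with integer coefficients, e.g. x - x ≈ 0, in R.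
module IntegerSolver {c ℓ : Level} (R : CommutativeRing c ℓ) where
  open CommutativeRing R
  open import Algebra.Properties.Ring ring using (-‿distribˡ-*; -‿distribʳ-*; -‿involutive; -‿anti-homo-+; -0#≈0#)
  open import Algebra.Properties.Semiring.Mult semiring using (×-homo-+; ×1-homo-*) renaming (_×_ to _·ℕ_)
  open import Relation.Binary.Reasoning.Setoid setoid

  fromℕ : ℕ → Carrier
  fromℕ n = n ·ℕ 1#

  fromℤ : ℤ.ℤ → Carrier
  fromℤ (ℤ.+ n) = fromℕ n
  fromℤ ℤ.-[1+ n ] = - fromℕ (suc n)

  fromSign : Sign → Carrier
  fromSign Sign.+ = 1#
  fromSign Sign.- = - 1#

  cancel-1 : ∀ a b → (1# + a) - (1# + b) ≈ a - b
  cancel-1 a b = begin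
    (1# + a) + - (1# + b)     ≈⟨ +-congˡ (trans (-‿anti-homo-+ 1# b) (+-comm _ _)) ⟩
    (1# + a) + (- 1# + - b)   ≈⟨ +-assoc _ _ _ ⟩
    1# + (a + (- 1# + - b))   ≈⟨ +-congˡ (trans (sym (+-assoc _ _ _)) (trans (+-congʳ (+-comm _ _)) (+-assoc _ _ _))) ⟩
    1# + (- 1# + (a + - b))   ≈⟨ sym (+-assoc _ _ _) ⟩
    (1# + - 1#) + (a - b)     ≈⟨ trans (+-congʳ (-‿inverseʳ 1#)) (+-identityˡ _) ⟩
    a - b                     ∎

  fromℤ-⊖ : ∀ m n → fromℤ (m ℤ.⊖ n) ≈ fromℕ m - fromℕ n
  fromℤ-⊖ zero zero = sym (-‿inverseʳ 0#)
  fromℤ-⊖ zero (suc n) = sym (+-identityˡ _)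
  fromℤ-⊖ (suc m) zero = sym (trans (+-congˡ -0#≈0#) (+-identityʳ _))
  fromℤ-⊖ (suc m) (suc n) rewrite ℤP.[1+m]⊖[1+n]≡m⊖n m n =
    trans (fromℤ-⊖ m n) (sym (cancel-1 (fromℕ m) (fromℕ n)))

  fromℤ-neg : ∀ i → fromℤ (ℤ.- i) ≈ - fromℤ i
  fromℤ-neg (ℤ.+ zero) = sym -0#≈0#
  fromℤ-neg (ℤ.+ suc n) = refl
  fromℤ-neg ℤ.-[1+ n ] = sym (-‿involutive _)

  fromℤ-+ : ∀ i j → fromℤ (i ℤ.+ j) ≈ fromℤ i + fromℤ j
  fromℤ-+ (ℤ.+ m) (ℤ.+ n) = ×-homo-+ 1# m n
  fromℤ-+ (ℤ.+ m) ℤ.-[1+ n ] = fromℤ-⊖ m (suc n)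
  fromℤ-+ ℤ.-[1+ m ] (ℤ.+ n) = trans (fromℤ-⊖ n (suc m)) (+-comm _ _)
  fromℤ-+ ℤ.-[1+ m ] ℤ.-[1+ n ] = begin
    - fromℕ (suc (suc m ℕ.+ n))     ≡⟨ P.cong (λ k → - fromℕ k) (P.sym (ℕP.+-suc (suc m) n)) ⟩
    - fromℕ (suc m ℕ.+ suc n)       ≈⟨ -‿cong (×-homo-+ 1# (suc m) (suc n)) ⟩
    - (fromℕ (suc m) + fromℕ (suc n)) ≈⟨ -‿anti-homo-+ _ _ ⟩
    - fromℕ (suc n) + - fromℕ (suc m) ≈⟨ +-comm _ _ ⟩
    - fromℕ (suc m) + - fromℕ (suc n) ∎

  fromSign-* : ∀ s t → fromSign (s Sign.* t) ≈ fromSign s * fromSign t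
  fromSign-* Sign.+ t = sym (*-identityˡ _)
  fromSign-* Sign.- Sign.+ = sym (*-identityʳ _)
  fromSign-* Sign.- Sign.- = begin
    1#           ≈⟨ sym (-‿involutive _) ⟩
    - - 1#       ≈⟨ -‿cong (sym (*-identityʳ _)) ⟩
    - (- 1# * 1#) ≈⟨ -‿distribʳ-* _ _ ⟩
    - 1# * - 1#  ∎

  fromℤ-◃ : ∀ s n → fromℤ (s ℤ.◃ n) ≈ fromSign s * fromℕ n
  fromℤ-◃ s zero = sym (zeroʳ _)
  fromℤ-◃ Sign.+ (suc n) = sym (*-identityˡ _)
  fromℤ-◃ Sign.- (suc n) = trans (-‿cong (sym (*-identityˡ _))) (-‿distribˡ-* _ _)

  fromℤ-sign : ∀ i → fromℤ i ≈ fromSign (ℤ.sign i) * fromℕ ℤ.∣ i ∣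
  fromℤ-sign i = P.subst (λ z → fromℤ z ≈ fromSign (ℤ.sign i) * fromℕ ℤ.∣ i ∣) (ℤP.◃-inverse i)
                   (fromℤ-◃ (ℤ.sign i) ℤ.∣ i ∣)

  interchange : ∀ a b x y → (a * b) * (x * y) ≈ (a * x) * (b * y)
  interchange a b x y = begin
    (a * b) * (x * y) ≈⟨ *-assoc _ _ _ ⟩
    a * (b * (x * y)) ≈⟨ *-congˡ (trans (sym (*-assoc _ _ _)) (trans (*-congʳ (*-comm _ _)) (*-assoc _ _ _))) ⟩
    a * (x * (b * y)) ≈⟨ sym (*-assoc _ _ _) ⟩
    (a * x) * (b * y) ∎

  fromℤ-* : ∀ i j → fromℤ (i ℤ.* j) ≈ fromℤ i * fromℤ j
  fromℤ-* i j = begin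
    fromℤ (i ℤ.* j)
      ≈⟨ fromℤ-◃ (ℤ.sign i Sign.* ℤ.sign j) (ℤ.∣ i ∣ ℕ.* ℤ.∣ j ∣) ⟩
    fromSign (ℤ.sign i Sign.* ℤ.sign j) * fromℕ (ℤ.∣ i ∣ ℕ.* ℤ.∣ j ∣)
      ≈⟨ *-cong (fromSign-* (ℤ.sign i) (ℤ.sign j)) (×1-homo-* ℤ.∣ i ∣ ℤ.∣ j ∣) ⟩
    (fromSign (ℤ.sign i) * fromSign (ℤ.sign j)) * (fromℕ ℤ.∣ i ∣ * fromℕ ℤ.∣ j ∣)
      ≈⟨ interchange _ _ _ _ ⟩
    (fromSign (ℤ.sign i) * fromℕ ℤ.∣ i ∣) * (fromSign (ℤ.sign j) * fromℕ ℤ.∣ j ∣)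
      ≈⟨ sym (*-cong (fromℤ-sign i) (fromℤ-sign j)) ⟩
    fromℤ i * fromℤ j ∎

  ℤ-morphism : ℤ.+-*-rawRing -Raw-AlmostCommutative⟶ ACR.fromCommutativeRing R
  ℤ-morphism = record
    { ⟦_⟧ = fromℤ ; +-homo = fromℤ-+ ; *-homo = fromℤ-* ; -‿homo = fromℤ-neg
    ; 0-homo = refl ; 1-homo = +-identityʳ 1# }

  equal-coefficients? : ∀ i j → Maybe (fromℤ i ≈ fromℤ j)
  equal-coefficients? i j with i ℤ.≟ j
  ... | yes P.refl = just refl
  ... | no _ = nothing

  open import Algebra.Solver.Ring ℤ.+-*-rawRing (ACR.fromCommutativeRing R) ℤ-morphism equal-coefficients?
    public using (solve; _:+_; _:*_; _:-_; :-_; con; _:=_)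

module Spans {c ℓ : Level} (R : CommutativeRing c ℓ) where
  open CommutativeRing R public hiding (zero)
  open import Algebra.Properties.Ring ring public using (-‿distribˡ-*; -0#≈0#; -1*x≈-x)
  open import Relation.Binary.Reasoning.Setoid setoid public
  open LinAlg R public
  open IntegerSolver R public using (solve; _:+_; _:*_; _:-_; :-_; con; _:=_)

  sumF-cong : ∀ {k} {f g : Fin k → Carrier} → (∀ i → f i ≈ g i) → sumF f ≈ sumF g
  sumF-cong {zero} e = refl
  sumF-cong {suc k} e = +-cong (e zero) (sumF-cong (λ i → e (suc i)))

  sumF-+ : ∀ {k} (f g : Fin k → Carrier) → sumF (λ i → f i + g i) ≈ sumF f + sumF g
  sumF-+ {zero} f g = sym (+-identityˡ _)
  sumF-+ {suc k} f g = trans (+-congˡ (sumF-+ (λ i → f (suc i)) (λ i → g (suc i))))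
    (solve 4 (λ a b x y → (a :+ b) :+ (x :+ y) := (a :+ x) :+ (b :+ y)) refl _ _ _ _)

  sumF-*ˡ : ∀ {k} a (f : Fin k → Carrier) → a * sumF f ≈ sumF (λ i → a * f i)
  sumF-*ˡ {zero} a f = zeroʳ a
  sumF-*ˡ {suc k} a f = trans (distribˡ _ _ _) (+-congˡ (sumF-*ˡ a (λ i → f (suc i))))

  sumF-*ʳ : ∀ {k} a (f : Fin k → Carrier) → sumF f * a ≈ sumF (λ i → f i * a)
  sumF-*ʳ {k} a f = trans (*-comm _ _) (trans (sumF-*ˡ a f) (sumF-cong {k} (λ i → *-comm _ _)))

  sumF-zero : ∀ {k} (f : Fin k → Carrier) → (∀ i → f i ≈ 0#) → sumF f ≈ 0#
  sumF-zero {zero} f e = refl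
  sumF-zero {suc k} f e = trans (+-cong (e zero) (sumF-zero _ (λ i → e (suc i)))) (+-identityˡ 0#)

  sumF-neg : ∀ {k} (f : Fin k → Carrier) → sumF (λ i → - f i) ≈ - sumF f
  sumF-neg {zero} f = sym -0#≈0#
  sumF-neg {suc k} f = trans (+-congˡ (sumF-neg (λ i → f (suc i))))
    (solve 2 (λ a b → :- a :+ :- b := :- (a :+ b)) refl _ _)

  sumF-swap : ∀ {k j} (g : Fin k → Fin j → Carrier) →
    sumF (λ i → sumF (λ t → g i t)) ≈ sumF (λ t → sumF (λ i → g i t))
  sumF-swap {zero} {j} g = sym (sumF-zero {j} _ (λ _ → refl))
  sumF-swap {suc k} {j} g =
    trans (+-congˡ (sumF-swap (λ i → g (suc i)))) (sym (sumF-+ {j} (g zero) (λ t → sumF (λ i → g (suc i) t))))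

  sumF-pull : ∀ {k} (p : Fin (suc k)) (f : Fin (suc k) → Carrier) →
    sumF f ≈ f p + sumF (λ i → f (punchIn p i))
  sumF-pull zero f = refl
  sumF-pull {suc k} (suc p) f = begin
    f zero + sumF (λ i → f (suc i))                            ≈⟨ +-congˡ (sumF-pull p (λ i → f (suc i))) ⟩
    f zero + (f (suc p) + sumF (λ i → f (suc (punchIn p i)))) ≈⟨ solve 3 (λ a b x → a :+ (b :+ x) := b :+ (a :+ x)) refl _ _ _ ⟩
    f (suc p) + (f zero + sumF (λ i → f (suc (punchIn p i)))) ∎

  infixl 6 _+ᵛ_ _-ᵛ_
  infixl 7 _·ᵛ_
  _+ᵛ_ _-ᵛ_ : ∀ {k} → Vecᶠ k → Vecᶠ k → Vecᶠ k
  (u +ᵛ v) j = u j + v j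
  (u -ᵛ v) j = u j - v j

  _·ᵛ_ : ∀ {k} → Carrier → Vecᶠ k → Vecᶠ k
  (a ·ᵛ v) j = a * v j

  ≈ᵛ-refl : ∀ {k} {u : Vecᶠ k} → u ≈ᵛ u
  ≈ᵛ-refl j = refl

  ≈ᵛ-sym : ∀ {k} {u v : Vecᶠ k} → u ≈ᵛ v → v ≈ᵛ u
  ≈ᵛ-sym e j = sym (e j)

  ≈ᵛ-trans : ∀ {k} {u v w : Vecᶠ k} → u ≈ᵛ v → v ≈ᵛ w → u ≈ᵛ w
  ≈ᵛ-trans e f j = trans (e j) (f j)

  lincomb-cong : ∀ {r k} {cs ds : Fin r → Carrier} (A : Mat r k) → (∀ i → cs i ≈ ds i) →
    lincomb cs A ≈ᵛ lincomb ds A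
  lincomb-cong {r} A e j = sumF-cong {r} (λ i → *-congʳ (e i))

  lincomb-congʳ : ∀ {r k} (cs : Fin r → Carrier) {A B : Mat r k} → (∀ i → A i ≈ᵛ B i) →
    lincomb cs A ≈ᵛ lincomb cs B
  lincomb-congʳ {r} cs e j = sumF-cong {r} (λ i → *-congˡ (e i j))

  lincomb-+ : ∀ {r k} (cs ds : Fin r → Carrier) (A : Mat r k) →
    lincomb (λ i → cs i + ds i) A ≈ᵛ (lincomb cs A +ᵛ lincomb ds A)
  lincomb-+ {r} cs ds A j = trans (sumF-cong {r} (λ i → distribʳ _ _ _)) (sumF-+ (λ i → cs i * A i j) (λ i → ds i * A i j))

  lincomb-· : ∀ {r k} a (cs : Fin r → Carrier) (A : Mat r k) →
    lincomb (λ i → a * cs i) A ≈ᵛ (a ·ᵛ lincomb cs A)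
  lincomb-· {r} a cs A j = trans (sumF-cong {r} (λ i → *-assoc _ _ _)) (sym (sumF-*ˡ a (λ i → cs i * A i j)))

  lincomb-0 : ∀ {r k} (A : Mat r k) → lincomb (λ _ → 0#) A ≈ᵛ 0ᵛ
  lincomb-0 {r} A j = sumF-zero {r} _ (λ i → zeroˡ _)

  lincomb-of-0 : ∀ {r k} (cs : Fin r → Carrier) (A : Mat r k) → (∀ i → A i ≈ᵛ 0ᵛ) → lincomb cs A ≈ᵛ 0ᵛ
  lincomb-of-0 {r} cs A e j = sumF-zero {r} _ (λ i → trans (*-congˡ (e i j)) (zeroʳ _))

  δ : ∀ {r} → Fin r → Fin r → Carrier
  δ zero zero = 1#
  δ zero (suc j) = 0#
  δ (suc i) zero = 0#
  δ (suc i) (suc j) = δ i j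

  lincomb-δ : ∀ {r k} (p : Fin r) (A : Mat r k) → lincomb (δ p) A ≈ᵛ A p
  lincomb-δ {suc r} zero A j = trans (+-cong (*-identityˡ _) (sumF-zero {r} _ (λ i → zeroˡ _))) (+-identityʳ _)
  lincomb-δ {suc r} (suc p) A j = trans (+-cong (zeroˡ _) (lincomb-δ p (λ i → A (suc i)) j)) (+-identityˡ _)

  lincomb-lincomb : ∀ {r s k} (cs : Fin r → Carrier) (C : Mat r s) (B : Mat s k) →
    lincomb cs (λ i → lincomb (C i) B) ≈ᵛ lincomb (lincomb cs C) B
  lincomb-lincomb cs C B j = begin
    sumF (λ i → cs i * sumF (λ t → C i t * B t j))   ≈⟨ sumF-cong (λ i → sumF-*ˡ (cs i) (λ t → C i t * B t j)) ⟩
    sumF (λ i → sumF (λ t → cs i * (C i t * B t j))) ≈⟨ sumF-swap (λ i t → cs i * (C i t * B t j)) ⟩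
    sumF (λ t → sumF (λ i → cs i * (C i t * B t j))) ≈⟨ sumF-cong (λ t → sumF-cong (λ i → sym (*-assoc (cs i) (C i t) (B t j)))) ⟩
    sumF (λ t → sumF (λ i → (cs i * C i t) * B t j)) ≈⟨ sumF-cong (λ t → sym (sumF-*ʳ (B t j) (λ i → cs i * C i t))) ⟩
    sumF (λ t → sumF (λ i → cs i * C i t) * B t j)   ∎

  ∈span-cong : ∀ {r k} {A : Mat r k} {u v : Vecᶠ k} → u ≈ᵛ v → u ∈span A → v ∈span A
  ∈span-cong e (cs , h) = cs , λ j → trans (sym (e j)) (h j)

  ∈span-row : ∀ {r k} (A : Mat r k) i → A i ∈span A
  ∈span-row A i = δ i , ≈ᵛ-sym (lincomb-δ i A)

  ∈span-0 : ∀ {r k} (A : Mat r k) → 0ᵛ ∈span A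
  ∈span-0 A = (λ _ → 0#) , ≈ᵛ-sym (lincomb-0 A)

  ∈span-+ : ∀ {r k} {A : Mat r k} {u v : Vecᶠ k} → u ∈span A → v ∈span A → (u +ᵛ v) ∈span A
  ∈span-+ {A = A} (cs , h) (ds , g) =
    (λ i → cs i + ds i) , λ j → trans (+-cong (h j) (g j)) (sym (lincomb-+ cs ds A j))

  ∈span-· : ∀ {r k} {A : Mat r k} a {u : Vecᶠ k} → u ∈span A → (a ·ᵛ u) ∈span A
  ∈span-· {A = A} a (cs , h) = (λ i → a * cs i) , λ j → trans (*-congˡ (h j)) (sym (lincomb-· a cs A j))

  ∈span-- : ∀ {r k} {A : Mat r k} {u v : Vecᶠ k} → u ∈span A → v ∈span A → (u -ᵛ v) ∈span A
  ∈span-- hu hv = ∈span-cong (λ j → +-congˡ (-1*x≈-x _))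
                    (∈span-+ hu (∈span-· (- 1#) hv))

module FieldFacts {c ℓ : Level} (R : CommutativeRing c ℓ) (isField : IsField R)
                  (_≟_ : Decidable (CommutativeRing._≈_ R)) where
  open Spans R public
  open IsField isField public

  inv : ∀ x → ¬ x ≈ 0# → Carrier
  inv x p = proj₁ (inverse x p)

  inv-r : ∀ x p → x * inv x p ≈ 1#
  inv-r x p = proj₂ (inverse x p)

  inv-l : ∀ x p → inv x p * x ≈ 1#
  inv-l x p = trans (*-comm _ _) (inv-r x p)

  inv-unique : ∀ {a b} (pa : ¬ a ≈ 0#) → a * b ≈ 1# → b ≈ inv a pa
  inv-unique {a} {b} pa e = begin
    b                  ≈⟨ sym (*-identityʳ b) ⟩
    b * 1#             ≈⟨ *-congˡ (sym (inv-r a pa)) ⟩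
    b * (a * inv a pa) ≈⟨ sym (*-assoc _ _ _) ⟩
    (b * a) * inv a pa ≈⟨ *-congʳ (trans (*-comm _ _) e) ⟩
    1# * inv a pa      ≈⟨ *-identityˡ _ ⟩
    inv a pa           ∎

  inv-cong : ∀ {a b} (pa : ¬ a ≈ 0#) (pb : ¬ b ≈ 0#) → a ≈ b → inv a pa ≈ inv b pb
  inv-cong {a} pa pb e = inv-unique pb (trans (*-congʳ (sym e)) (inv-r a pa))

  cancel : ∀ {a x} → ¬ a ≈ 0# → a * x ≈ 0# → x ≈ 0#
  cancel {a} {x} p e = begin
    x                 ≈⟨ sym (*-identityˡ x) ⟩
    1# * x            ≈⟨ *-congʳ (sym (inv-l a p)) ⟩
    (inv a p * a) * x ≈⟨ *-assoc _ _ _ ⟩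
    inv a p * (a * x) ≈⟨ *-congˡ e ⟩
    inv a p * 0#      ≈⟨ zeroʳ _ ⟩
    0#                ∎

  1≉0 : ¬ 1# ≈ 0#
  1≉0 e = 0≉1 (sym e)

  NonZero : ∀ {k} → Vecᶠ k → Set ℓ
  NonZero x = ∃ λ j → ¬ x j ≈ 0#

  zero-or-nonzero : ∀ {k} (f : Vecᶠ k) → f ≈ᵛ 0ᵛ ⊎ NonZero f
  zero-or-nonzero {zero} f = inj₁ (λ ())
  zero-or-nonzero {suc k} f with f zero ≟ 0#
  ... | no p = inj₂ (zero , p)
  ... | yes p with zero-or-nonzero (λ i → f (suc i))
  ...   | inj₂ (i , q) = inj₂ (suc i , q)
  ...   | inj₁ h = inj₁ λ { zero → p ; (suc i) → h i }

  dropZeroColumn-independent : ∀ {k j} (C : Mat k (suc j)) → (∀ i → C i zero ≈ 0#) →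
    Independent C → Independent (λ i t → C i (suc t))
  dropZeroColumn-independent C allZero ind cs h = ind cs λ
    { zero → sumF-zero _ (λ i → trans (*-congˡ (allZero i)) (zeroʳ _))
    ; (suc t) → h t }

  sumF-eliminate : ∀ {k} (d a b : Fin k → Carrier) x y →
    sumF (λ i → d i * (a i - (b i * x) * y)) ≈ sumF (λ i → d i * a i) - (sumF (λ i → d i * b i) * x) * y
  sumF-eliminate {zero} d a b x y = solve 2 (λ x y → con (ℤ.+ 0) := con (ℤ.+ 0) :- (con (ℤ.+ 0) :* x) :* y) refl x y
  sumF-eliminate {suc k} d a b x y =
    trans (+-congˡ (sumF-eliminate (λ i → d (suc i)) (λ i → a (suc i)) (λ i → b (suc i)) x y))
      (solve 7 (λ d₀ a₀ b₀ x y A B → d₀ :* (a₀ :- (b₀ :* x) :* y) :+ (A :- (B :* x) :* y)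
                   := (d₀ :* a₀ :+ A) :- ((d₀ :* b₀ :+ B) :* x) :* y) refl _ _ _ _ _ _ _)

  clearColumn : ∀ {k j} (C : Mat (suc k) (suc j)) (p : Fin (suc k)) → ¬ C p zero ≈ 0# → Mat k j
  clearColumn C p nz i t = C (punchIn p i) (suc t) - (C (punchIn p i) zero * inv (C p zero) nz) * C p (suc t)

  -- A dependency among the cleared rows lifts to one among the rows of C,
  -- with coefficient c₀ on the pivot row chosen to cancel the first column.
  clearColumn-independent : ∀ {k j} (C : Mat (suc k) (suc j)) p nz →
    Independent C → Independent (clearColumn C p nz)
  clearColumn-independent {k} C p nz ind d h i =
    P.subst (λ z → z ≈ 0#) (insertAt-punchIn d p c₀ i) (ind cs combination-zero (punchIn p i))
    where
    ip = inv (C p zero) nz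
    s₀ = sumF (λ i → d i * C (punchIn p i) zero)
    c₀ = - (s₀ * ip)
    cs = insertAt d p c₀
    split : ∀ t → lincomb cs C t ≈ c₀ * C p t + sumF (λ i → d i * C (punchIn p i) t)
    split t = trans (sumF-pull p (λ i → cs i * C i t))
                (+-cong (*-congʳ (reflexive (insertAt-lookup d p c₀)))
                        (sumF-cong {k} (λ i → *-congʳ (reflexive (insertAt-punchIn d p c₀ i)))))
    rest : ∀ t → sumF (λ i → d i * C (punchIn p i) (suc t)) ≈ (s₀ * ip) * C p (suc t)
    rest t = begin
      sumF (λ i → d i * C (punchIn p i) (suc t))
        ≈⟨ solve 2 (λ a b → a := a :- b :+ b) refl _ _ ⟩
      sumF (λ i → d i * C (punchIn p i) (suc t)) - (s₀ * ip) * C p (suc t) + (s₀ * ip) * C p (suc t)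
        ≈⟨ +-congʳ (trans (sym (sumF-eliminate d _ _ ip (C p (suc t)))) (h t)) ⟩
      0# + (s₀ * ip) * C p (suc t)
        ≈⟨ +-identityˡ _ ⟩
      (s₀ * ip) * C p (suc t) ∎
    combination-zero : lincomb cs C ≈ᵛ 0ᵛ
    combination-zero zero = trans (split zero) (begin
      - (s₀ * ip) * C p zero + s₀   ≈⟨ +-congʳ (sym (-‿distribˡ-* _ _)) ⟩
      - ((s₀ * ip) * C p zero) + s₀ ≈⟨ +-congʳ (-‿cong (trans (*-assoc _ _ _) (trans (*-congˡ (inv-l _ nz)) (*-identityʳ _)))) ⟩
      - s₀ + s₀                     ≈⟨ -‿inverseˡ s₀ ⟩
      0#                            ∎)
    combination-zero (suc t) = trans (split (suc t)) (trans (+-congˡ (rest t))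
      (solve 2 (λ a b → :- a :* b :+ a :* b := con (ℤ.+ 0)) refl (s₀ * ip) (C p (suc t))))

  independent-bound : ∀ {k j} (C : Mat k j) → Independent C → k ℕ.≤ j
  independent-bound {zero} C ind = z≤n
  independent-bound {suc k} {zero} C ind = ⊥-elim (1≉0 (ind (λ _ → 1#) (λ ()) zero))
  independent-bound {suc k} {suc j} C ind with zero-or-nonzero (λ i → C i zero)
  ... | inj₁ allZero = ℕP.m≤n⇒m≤1+n (independent-bound (λ i t → C i (suc t)) (dropZeroColumn-independent C allZero ind))
  ... | inj₂ (p , nz) = s≤s (independent-bound _ (clearColumn-independent C p nz ind))

  steinitz : ∀ {k s t} (A : Mat k t) (B : Mat s t) → Independent A → (∀ i → A i ∈span B) → k ℕ.≤ s
  steinitz A B ind hA = independent-bound C independent-C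
    where
    C = λ i → proj₁ (hA i)
    independent-C : Independent C
    independent-C cs h = ind cs (≈ᵛ-trans (lincomb-congʳ cs (λ i → proj₂ (hA i)))
                                (≈ᵛ-trans (lincomb-lincomb cs C B) (≈ᵛ-trans (lincomb-cong B h) (lincomb-0 B))))

module Masks where
  trues : ∀ {n} → (Fin n → Bool) → ℕ
  trues {zero} f = 0
  trues {suc n} f = (if f zero then 1 else 0) ℕ.+ trues (λ i → f (suc i))

  falses : ∀ {n} → (Fin n → Bool) → ℕ
  falses {zero} f = 0
  falses {suc n} f = (if f zero then 0 else 1) ℕ.+ falses (λ i → f (suc i))

  trues+falses : ∀ {n} (f : Fin n → Bool) → trues f ℕ.+ falses f ≡ n
  trues+falses {zero} f = P.refl
  trues+falses {suc n} f with f zero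
  ... | true = P.cong suc (trues+falses (λ i → f (suc i)))
  ... | false = P.trans (ℕP.+-suc _ _) (P.cong suc (trues+falses (λ i → f (suc i))))

  trues-empty : ∀ n → trues {n} (λ _ → false) ≡ 0
  trues-empty zero = P.refl
  trues-empty (suc n) = trues-empty n

  falses-complement : ∀ {n} (f : Fin n → Bool) {t} → trues f ≡ t → falses f ≡ n ∸ t
  falses-complement {n} f {t} e =
    P.trans (P.sym (ℕP.m+n∸m≡n (trues f) (falses f))) (P.cong₂ _∸_ (trues+falses f) e)

  mark : ∀ {n} → (Fin n → Bool) → Fin n → Fin n → Bool
  mark f zero zero = true
  mark f zero (suc j) = f (suc j)
  mark f (suc p) zero = f zero
  mark f (suc p) (suc j) = mark (λ i → f (suc i)) p j

  mark-here : ∀ {n} (f : Fin n → Bool) p → mark f p p ≡ true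
  mark-here f zero = P.refl
  mark-here f (suc p) = mark-here (λ i → f (suc i)) p

  mark-keeps : ∀ {n} (f : Fin n → Bool) p j → f j ≡ true → mark f p j ≡ true
  mark-keeps f zero zero e = P.refl
  mark-keeps f zero (suc j) e = e
  mark-keeps f (suc p) zero e = e
  mark-keeps f (suc p) (suc j) e = mark-keeps (λ i → f (suc i)) p j e

  mark-marked : ∀ {n} (f : Fin n → Bool) p j → mark f p j ≡ true → f j ≡ true ⊎ j ≡ p
  mark-marked f zero zero e = inj₂ P.refl
  mark-marked f zero (suc j) e = inj₁ e
  mark-marked f (suc p) zero e = inj₁ e
  mark-marked f (suc p) (suc j) e with mark-marked (λ i → f (suc i)) p j e
  ... | inj₁ old = inj₁ old
  ... | inj₂ P.refl = inj₂ P.refl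

  trues-mark : ∀ {n} (f : Fin n → Bool) p → f p ≡ false → trues (mark f p) ≡ suc (trues f)
  trues-mark f zero e rewrite e = P.refl
  trues-mark {suc n} f (suc p) e with f zero
  ... | true = P.cong suc (trues-mark (λ i → f (suc i)) p e)
  ... | false = trues-mark (λ i → f (suc i)) p e

module Elimination {c ℓ : Level} (R : CommutativeRing c ℓ) (isField : IsField R)
                   (_≟_ : Decidable (CommutativeRing._≈_ R)) (n l : ℕ) where
  open FieldFacts R isField _≟_ public
  open Ambient n l public
  open Masks

  V : Set c
  V = Vecᶠ (n ℕ.+ l)

  _′ : V → Vecᶠ n
  (v ′) j = v (j ↑ˡ l)

  _″ : V → Vecᶠ l
  (v ″) j = v (n ↑ʳ j)

  ∈span-′ : ∀ {s} {B : Mat s (n ℕ.+ l)} {w} → w ∈span B → (w ′) ∈span firstCols B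
  ∈span-′ (cs , h) = cs , λ j → h (j ↑ˡ l)

  VanishesOn : (Fin n → Bool) → V → Set ℓ
  VanishesOn piv v = ∀ j → piv j ≡ true → v (j ↑ˡ l) ≈ 0#

  record Reduction {r} (W : Mat r (n ℕ.+ l)) : Set (c ⊔ ℓ) where
    field
      piv : Fin n → Bool
      piv-count : trues piv ≡ r
      red : V → V
      red-cong : ∀ {u v} → u ≈ᵛ v → red u ≈ᵛ red v
      red-linear : ∀ a u v → red (a ·ᵛ u +ᵛ v) ≈ᵛ (a ·ᵛ red u +ᵛ red v)
      red-diff : ∀ v → (v -ᵛ red v) ∈span W
      red-piv : ∀ v → VanishesOn piv (red v)
      red-fix : ∀ v → VanishesOn piv v → red v ≈ᵛ v
      red-W : ∀ i → red (W i) ≈ᵛ 0ᵛ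

  noReduction : (W : Mat 0 (n ℕ.+ l)) → Reduction W
  noReduction W = record
    { piv = λ _ → false ; piv-count = trues-empty n ; red = λ v → v ; red-cong = λ e → e
    ; red-linear = λ a u v j → refl
    ; red-diff = λ v → ∈span-cong {A = W} (λ j → sym (-‿inverseʳ (v j))) (∈span-0 W)
    ; red-piv = λ v j () ; red-fix = λ v _ → ≈ᵛ-refl ; red-W = λ () }

  -- Adding the row W₀ to a reduction D of the remaining rows: D sends W₀
  -- to a vector u with u′ ≠ 0; a nonzero entry p of u′ becomes a new pivot
  -- and the new reduction is v ↦ D v - (D v)ₚ / uₚ · u.
  module Extend {r} (W : Mat (suc r) (n ℕ.+ l)) (ind : Independent (firstCols W))
                (D : Reduction (λ i → W (suc i))) where
    open Reduction D renaming (red to red₀)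
    Wt : Mat r (n ℕ.+ l)
    Wt i = W (suc i)
    u = red₀ (W zero)

    ∈span-tail : ∀ {v} → v ∈span Wt → v ∈span W
    ∈span-tail (cs , h) = (λ { zero → 0# ; (suc i) → cs i }) ,
      λ j → trans (h j) (sym (trans (+-congʳ (zeroˡ _)) (+-identityˡ _)))

    u∈W : u ∈span W
    u∈W = ∈span-cong {A = W} (λ j → solve 2 (λ w u → w :- (w :- u) := u) refl _ _)
            (∈span-- {A = W} (∈span-row W zero) (∈span-tail (red-diff (W zero))))

    -- u′ = 0 would make W₀′ a combination of the other rows of W′.
    u′-nonzero : NonZero (u ′)
    u′-nonzero with zero-or-nonzero (u ′)
    ... | inj₂ nz = nz
    ... | inj₁ u′≈0 = ⊥-elim (1≉0 (ind cs dependency zero))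
      where
      d = proj₁ (red-diff (W zero))
      cs : Fin (suc r) → Carrier
      cs zero = 1#
      cs (suc i) = - d i
      dependency : lincomb cs (firstCols W) ≈ᵛ 0ᵛ
      dependency j = begin
        1# * W zero (j ↑ˡ l) + sumF (λ i → - d i * Wt i (j ↑ˡ l))
          ≈⟨ +-cong (*-identityˡ _) (trans (sumF-cong {r} (λ i → sym (-‿distribˡ-* _ _))) (sumF-neg (λ i → d i * Wt i (j ↑ˡ l)))) ⟩
        W zero (j ↑ˡ l) - lincomb d Wt (j ↑ˡ l)
          ≈⟨ +-congˡ (-‿cong (sym (proj₂ (red-diff (W zero)) (j ↑ˡ l)))) ⟩
        W zero (j ↑ˡ l) - (W zero (j ↑ˡ l) - u (j ↑ˡ l))
          ≈⟨ +-congˡ (-‿cong (+-congˡ (-‿cong (u′≈0 j)))) ⟩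
        W zero (j ↑ˡ l) - (W zero (j ↑ˡ l) - 0#)
          ≈⟨ solve 1 (λ a → a :- (a :- con (ℤ.+ 0)) := con (ℤ.+ 0)) refl _ ⟩
        0# ∎

    p = proj₁ u′-nonzero
    uₚ = u (p ↑ˡ l)
    uₚ≉0 = proj₂ u′-nonzero

    p-new : piv p ≡ false
    p-new with piv p in eq
    ... | false = P.refl
    ... | true = ⊥-elim (uₚ≉0 (red-piv (W zero) p eq))

    coef : V → Carrier
    coef v = red₀ v (p ↑ˡ l) * inv uₚ uₚ≉0

    red′ : V → V
    red′ v = red₀ v -ᵛ coef v ·ᵛ u

    red′-linear : ∀ a x y → red′ (a ·ᵛ x +ᵛ y) ≈ᵛ (a ·ᵛ red′ x +ᵛ red′ y)
    red′-linear a x y j = begin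
      red₀ (a ·ᵛ x +ᵛ y) j - (red₀ (a ·ᵛ x +ᵛ y) (p ↑ˡ l) * iu) * u j
        ≈⟨ +-cong (red-linear a x y j) (-‿cong (*-congʳ (*-congʳ (red-linear a x y (p ↑ˡ l))))) ⟩
      (a * red₀ x j + red₀ y j) - ((a * red₀ x (p ↑ˡ l) + red₀ y (p ↑ˡ l)) * iu) * u j
        ≈⟨ solve 7 (λ a x y xp yp i uj → (a :* x :+ y) :- ((a :* xp :+ yp) :* i) :* uj
                    := a :* (x :- (xp :* i) :* uj) :+ (y :- (yp :* i) :* uj)) refl _ _ _ _ _ _ _ ⟩
      a * red′ x j + red′ y j ∎
      where iu = inv uₚ uₚ≉0

    red′-diff : ∀ v → (v -ᵛ red′ v) ∈span W
    red′-diff v = ∈span-cong {A = W} (λ j → solve 4 (λ v r c u → (v :- r) :+ c :* u := v :- (r :- c :* u)) refl _ _ _ _)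
                    (∈span-+ {A = W} (∈span-tail (red-diff v)) (∈span-· {A = W} (coef v) u∈W))

    red′-piv : ∀ v → VanishesOn (mark piv p) (red′ v)
    red′-piv v j e with mark-marked piv p j e
    ... | inj₁ old = begin
      red₀ v (j ↑ˡ l) - coef v * u (j ↑ˡ l) ≈⟨ +-cong (red-piv v j old) (-‿cong (*-congˡ (red-piv (W zero) j old))) ⟩
      0# - coef v * 0#                      ≈⟨ solve 1 (λ c → con (ℤ.+ 0) :- c :* con (ℤ.+ 0) := con (ℤ.+ 0)) refl _ ⟩
      0#                                    ∎
    ... | inj₂ P.refl = begin
      red₀ v (p ↑ˡ l) - (red₀ v (p ↑ˡ l) * inv uₚ uₚ≉0) * uₚ
        ≈⟨ +-congˡ (-‿cong (trans (*-assoc _ _ _) (trans (*-congˡ (inv-l uₚ uₚ≉0)) (*-identityʳ _)))) ⟩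
      red₀ v (p ↑ˡ l) - red₀ v (p ↑ˡ l)
        ≈⟨ -‿inverseʳ _ ⟩
      0# ∎

    red′-fix : ∀ v → VanishesOn (mark piv p) v → red′ v ≈ᵛ v
    red′-fix v z j = begin
      red₀ v j - (red₀ v (p ↑ˡ l) * iu) * u j
        ≈⟨ +-cong (red-fix v z₀ j) (-‿cong (*-congʳ (*-congʳ (trans (red-fix v z₀ (p ↑ˡ l)) (z p (mark-here piv p)))))) ⟩
      v j - (0# * iu) * u j
        ≈⟨ solve 3 (λ a b c → a :- (con (ℤ.+ 0) :* b) :* c := a) refl _ _ _ ⟩
      v j ∎
      where
      iu = inv uₚ uₚ≉0
      z₀ : VanishesOn piv v
      z₀ j e = z j (mark-keeps piv p j e)

    red′-W : ∀ i → red′ (W i) ≈ᵛ 0ᵛ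
    red′-W zero j = begin
      u j - (uₚ * inv uₚ uₚ≉0) * u j ≈⟨ +-congˡ (-‿cong (trans (*-congʳ (inv-r uₚ uₚ≉0)) (*-identityˡ _))) ⟩
      u j - u j                      ≈⟨ -‿inverseʳ _ ⟩
      0#                             ∎
    red′-W (suc i) j = begin
      red₀ (Wt i) j - (red₀ (Wt i) (p ↑ˡ l) * iu) * u j ≈⟨ +-cong (red-W i j) (-‿cong (*-congʳ (*-congʳ (red-W i (p ↑ˡ l))))) ⟩
      0# - (0# * iu) * u j                               ≈⟨ solve 2 (λ a b → con (ℤ.+ 0) :- (con (ℤ.+ 0) :* a) :* b := con (ℤ.+ 0)) refl _ _ ⟩
      0#                                                 ∎
      where iu = inv uₚ uₚ≉0

    reduction : Reduction W
    reduction = record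
      { piv = mark piv p
      ; piv-count = P.trans (trues-mark piv p p-new) (P.cong suc piv-count)
      ; red = red′
      ; red-cong = λ e j → +-cong (red-cong e j) (-‿cong (*-congʳ (*-congʳ (red-cong e (p ↑ˡ l)))))
      ; red-linear = red′-linear ; red-diff = red′-diff ; red-piv = red′-piv
      ; red-fix = red′-fix ; red-W = red′-W }

  reduce : ∀ {r} (W : Mat r (n ℕ.+ l)) → Independent (firstCols W) → Reduction W
  reduce {zero} W ind = noReduction W
  reduce {suc r} W ind = Extend.reduction W ind (reduce (λ i → W (suc i)) tail-independent)
    where
    tail-independent : Independent (firstCols (λ i → W (suc i)))
    tail-independent cs h i = ind (λ { zero → 0# ; (suc i) → cs i })
                                  (λ j → trans (+-congʳ (zeroˡ _)) (trans (+-identityˡ _) (h j))) (suc i)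

  module ReductionFacts {r} {W : Mat r (n ℕ.+ l)} (D : Reduction W) where
    open Reduction D

    red-0 : red 0ᵛ ≈ᵛ 0ᵛ
    red-0 = red-fix 0ᵛ (λ j _ → refl)

    red-· : ∀ a u → red (a ·ᵛ u) ≈ᵛ (a ·ᵛ red u)
    red-· a u = ≈ᵛ-trans (red-cong (λ j → sym (+-identityʳ _)))
                 (≈ᵛ-trans (red-linear a u 0ᵛ) (λ j → trans (+-congˡ (red-0 j)) (+-identityʳ _)))

    red-- : ∀ u v → red (u -ᵛ v) ≈ᵛ (red u -ᵛ red v)
    red-- u v = ≈ᵛ-trans (red-cong (λ j → +-cong (sym (*-identityˡ _)) (sym (-1*x≈-x _))))
                 (≈ᵛ-trans (red-linear 1# u (- 1# ·ᵛ v))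
                   (λ j → +-cong (*-identityˡ _) (trans (red-· (- 1#) v j) (-1*x≈-x _))))

    red-lincomb : ∀ {s} (cs : Fin s → Carrier) (A : Mat s (n ℕ.+ l)) →
      red (lincomb cs A) ≈ᵛ lincomb cs (λ i → red (A i))
    red-lincomb {zero} cs A = red-0
    red-lincomb {suc s} cs A =
      ≈ᵛ-trans (red-linear (cs zero) (A zero) (lincomb (λ i → cs (suc i)) (λ i → A (suc i))))
               (λ j → +-congˡ (red-lincomb (λ i → cs (suc i)) (λ i → A (suc i)) j))

    red-span : ∀ {v} → v ∈span W → red v ≈ᵛ 0ᵛ
    red-span (cs , h) = ≈ᵛ-trans (red-cong h) (≈ᵛ-trans (red-lincomb cs W) (lincomb-of-0 cs _ red-W))

    kernel-span : ∀ {v} → red v ≈ᵛ 0ᵛ → v ∈span W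
    kernel-span {v} z = ∈span-cong {A = W} (λ j → trans (+-congˡ (-‿cong (z j))) (trans (+-congˡ -0#≈0#) (+-identityʳ _)))
                          (red-diff v)

    -- red fixes E pointwise, hence (red v)′ depends only on v′.
    red-E : ∀ {v} → InE v → red v ≈ᵛ v
    red-E {v} e = red-fix v (λ j _ → e j)

    red′-cong : ∀ {u v} → (u ′) ≈ᵛ (v ′) → (red u ′) ≈ᵛ (red v ′)
    red′-cong {u} {v} e j = begin
      red u (j ↑ˡ l)                                   ≈⟨ solve 2 (λ a b → a := (a :- b) :+ b) refl _ _ ⟩
      (red u (j ↑ˡ l) - red v (j ↑ˡ l)) + red v (j ↑ˡ l) ≈⟨ +-congʳ (sym (red-- u v (j ↑ˡ l))) ⟩
      red (u -ᵛ v) (j ↑ˡ l) + red v (j ↑ˡ l)             ≈⟨ +-congʳ (trans (red-E difference-in-E (j ↑ˡ l)) (difference-in-E j)) ⟩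
      0# + red v (j ↑ˡ l)                                ≈⟨ +-identityˡ _ ⟩
      red v (j ↑ˡ l)                                     ∎
      where
      difference-in-E : InE (u -ᵛ v)
      difference-in-E i = trans (+-congʳ (e i)) (-‿inverseʳ _)

module Counting {c ℓ : Level} (R : CommutativeRing c ℓ) (q : ℕ) (hc : HasCard R q) where
  open Spans R
  open HasCard hc
  open Masks

  index : Carrier → Fin q
  index x = proj₁ (enum-surj x)

  index-cong : ∀ {x y} → x ≈ y → index x ≡ index y
  index-cong {x} {y} e = enum-inj _ _ (trans (proj₂ (enum-surj x)) (trans e (sym (proj₂ (enum-surj y)))))

  index-injective : ∀ {x y} → index x ≡ index y → x ≈ y
  index-injective {x} {y} e = trans (sym (proj₂ (enum-surj x))) (trans (reflexive (P.cong enum e)) (proj₂ (enum-surj y)))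

  index-enum : ∀ i → index (enum i) ≡ i
  index-enum i = enum-inj _ _ (proj₂ (enum-surj (enum i)))

  infix 4 _≟_
  _≟_ : Decidable _≈_
  x ≟ y = map′ index-injective index-cong (index x Fin.≟ index y)

  tl : ∀ {k} → Vecᶠ (suc k) → Vecᶠ k
  tl x i = x (suc i)

  encodeVec : ∀ {k} → Vecᶠ k → Fin (q ^ k)
  encodeVec {zero} x = zero
  encodeVec {suc k} x = combine (index (x zero)) (encodeVec (tl x))

  encodeVec-cong : ∀ {k} {x y : Vecᶠ k} → x ≈ᵛ y → encodeVec x ≡ encodeVec y
  encodeVec-cong {zero} e = P.refl
  encodeVec-cong {suc k} e = P.cong₂ combine (index-cong (e zero)) (encodeVec-cong (λ i → e (suc i)))

  encodeVec-injective : ∀ {k} {x y : Vecᶠ k} → encodeVec x ≡ encodeVec y → x ≈ᵛ y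
  encodeVec-injective {suc k} {x} {y} e
    with FinP.combine-injective (index (x zero)) (encodeVec (tl x)) (index (y zero)) (encodeVec (tl y)) e
  ... | e₀ , e₁ = λ { zero → index-injective e₀ ; (suc i) → encodeVec-injective e₁ i }

  encodeVec-surjective : ∀ {k} (t : Fin (q ^ k)) → ∃ λ (x : Vecᶠ k) → encodeVec x ≡ t
  encodeVec-surjective {zero} zero = (λ ()) , P.refl
  encodeVec-surjective {suc k} t with FinP.combine-surjective {q} {q ^ k} t
  ... | a , b , e with encodeVec-surjective {k} b
  ...   | y , ey = (λ { zero → enum a ; (suc i) → y i }) , P.trans (P.cong₂ combine (index-enum a) ey) e

  ZeroOnMask : ∀ {k} → (Fin k → Bool) → Vecᶠ k → Set ℓ
  ZeroOnMask piv x = ∀ j → piv j ≡ true → x j ≈ 0#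

  encodeMasked : ∀ {k} (piv : Fin k → Bool) → Vecᶠ k → Fin (q ^ falses piv)
  encodeMasked {zero} piv x = zero
  encodeMasked {suc k} piv x with piv zero
  ... | true = encodeMasked (λ i → piv (suc i)) (tl x)
  ... | false = combine (index (x zero)) (encodeMasked (λ i → piv (suc i)) (tl x))

  encodeMasked-cong : ∀ {k} (piv : Fin k → Bool) {x y : Vecᶠ k} → x ≈ᵛ y → encodeMasked piv x ≡ encodeMasked piv y
  encodeMasked-cong {zero} piv e = P.refl
  encodeMasked-cong {suc k} piv e with piv zero
  ... | true = encodeMasked-cong (λ i → piv (suc i)) (λ i → e (suc i))
  ... | false = P.cong₂ combine (index-cong (e zero)) (encodeMasked-cong (λ i → piv (suc i)) (λ i → e (suc i)))

  encodeMasked-injective : ∀ {k} (piv : Fin k → Bool) {x y : Vecᶠ k} → ZeroOnMask piv x → ZeroOnMask piv y →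
    encodeMasked piv x ≡ encodeMasked piv y → x ≈ᵛ y
  encodeMasked-injective {suc k} piv {x} {y} zx zy e with piv zero in eq
  ... | true = λ { zero → trans (zx zero eq) (sym (zy zero eq))
                 ; (suc i) → encodeMasked-injective (λ i → piv (suc i)) (λ j → zx (suc j)) (λ j → zy (suc j)) e i }
  ... | false with FinP.combine-injective (index (x zero)) (encodeMasked (λ i → piv (suc i)) (tl x))
                                          (index (y zero)) (encodeMasked (λ i → piv (suc i)) (tl y)) e
  ...   | e₀ , e₁ = λ { zero → index-injective e₀
                      ; (suc i) → encodeMasked-injective (λ i → piv (suc i)) (λ j → zx (suc j)) (λ j → zy (suc j)) e₁ i }

  encodeMasked-surjective : ∀ {k} (piv : Fin k → Bool) (t : Fin (q ^ falses piv)) →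
    ∃ λ (x : Vecᶠ k) → ZeroOnMask piv x × encodeMasked piv x ≡ t
  encodeMasked-surjective {zero} piv zero = (λ ()) , (λ ()) , P.refl
  encodeMasked-surjective {suc k} piv t with piv zero in eq
  ... | true with encodeMasked-surjective (λ i → piv (suc i)) t
  ...   | y , zy , ey = (λ { zero → 0# ; (suc i) → y i }) , (λ { zero _ → refl ; (suc j) → zy j }) , ey
  encodeMasked-surjective {suc k} piv t | false with FinP.combine-surjective {q} {q ^ falses (λ i → piv (suc i))} t
  ... | a , b , e with encodeMasked-surjective (λ i → piv (suc i)) b
  ...   | y , zy , ey = (λ { zero → enum a ; (suc i) → y i }) ,
                        (λ { zero marked → ⊥-elim (false≢true (P.trans (P.sym eq) marked)) ; (suc j) → zy j }) ,
                        P.trans (P.cong₂ combine (index-enum a) ey) e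
    where
    false≢true : false ≡ true → ⊥
    false≢true ()

-- Normalised vectors represent the points of projective space: there are
-- gauss1 q (#free) nonzero vectors vanishing on a mask whose first nonzero
-- entry is 1, and every nonzero vector is a unique multiple of one.
module ProjectivePoints {c ℓ : Level} (R : CommutativeRing c ℓ) (isField : IsField R)
                        (q : ℕ) (hc : HasCard R q) where
  open FieldFacts R isField (Counting._≟_ R q hc) public
  open Counting R q hc public
  open Masks

  -- One step of the definition: a masked entry is 0; a free entry is
  -- either the leading 1 (and the rest merely vanishes on the mask) or 0.
  NormalisedStep : Bool → Carrier → Set ℓ → Set ℓ → Set ℓ
  NormalisedStep true x₀ normalisedRest zeroRest = x₀ ≈ 0# × normalisedRest
  NormalisedStep false x₀ normalisedRest zeroRest = (x₀ ≈ 1# × zeroRest) ⊎ (x₀ ≈ 0# × normalisedRest)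

  Normalised : ∀ {k} → (Fin k → Bool) → Vecᶠ k → Set ℓ
  Normalised {zero} piv x = Lift ℓ ⊥
  Normalised {suc k} piv x =
    NormalisedStep (piv zero) (x zero) (Normalised (λ i → piv (suc i)) (tl x)) (ZeroOnMask (λ i → piv (suc i)) (tl x))

  -- The leading 1 sits at a free position: the q ^ (free positions after it)
  -- completions come first, then the points with first free entry 0.
  encodePoint : ∀ {k} (piv : Fin k → Bool) x → Normalised piv x → Fin (gauss1 q (falses piv))
  encodePoint {zero} piv x nx = ⊥-elim (lower nx)
  encodePoint {suc k} piv x nx with piv zero
  ... | true = encodePoint (λ i → piv (suc i)) (tl x) (proj₂ nx)
  ... | false with nx
  ...   | inj₁ _ = encodeMasked (λ i → piv (suc i)) (tl x) ↑ˡ gauss1 q (falses (λ i → piv (suc i)))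
  ...   | inj₂ (_ , n) = q ^ falses (λ i → piv (suc i)) ↑ʳ encodePoint (λ i → piv (suc i)) (tl x) n

  ↑ˡ≢↑ʳ : ∀ {a b} (i : Fin a) (j : Fin b) → i ↑ˡ b ≡ a ↑ʳ j → ⊥
  ↑ˡ≢↑ʳ {a} {b} i j e
    with P.trans (P.sym (FinP.splitAt-↑ˡ a i b)) (P.trans (P.cong (Fin.splitAt a) e) (FinP.splitAt-↑ʳ a b j))
  ... | ()

  encodePoint-cong : ∀ {k} (piv : Fin k → Bool) {x y} → x ≈ᵛ y → (nx : Normalised piv x) (ny : Normalised piv y) →
    encodePoint piv x nx ≡ encodePoint piv y ny
  encodePoint-cong {zero} piv e nx ny = ⊥-elim (lower nx)
  encodePoint-cong {suc k} piv e nx ny with piv zero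
  ... | true = encodePoint-cong (λ i → piv (suc i)) (λ i → e (suc i)) (proj₂ nx) (proj₂ ny)
  ... | false with nx | ny
  ...   | inj₁ _ | inj₁ _ = P.cong (_↑ˡ _) (encodeMasked-cong (λ i → piv (suc i)) (λ i → e (suc i)))
  ...   | inj₂ (_ , n) | inj₂ (_ , m) = P.cong (_ ↑ʳ_) (encodePoint-cong (λ i → piv (suc i)) (λ i → e (suc i)) n m)
  ...   | inj₁ (o , _) | inj₂ (z , _) = ⊥-elim (1≉0 (trans (sym o) (trans (e zero) z)))
  ...   | inj₂ (z , _) | inj₁ (o , _) = ⊥-elim (1≉0 (trans (sym o) (trans (sym (e zero)) z)))

  encodePoint-injective : ∀ {k} (piv : Fin k → Bool) {x y} (nx : Normalised piv x) (ny : Normalised piv y) →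
    encodePoint piv x nx ≡ encodePoint piv y ny → x ≈ᵛ y
  encodePoint-injective {zero} piv nx ny e = ⊥-elim (lower nx)
  encodePoint-injective {suc k} piv nx ny e with piv zero
  ... | true = λ { zero → trans (proj₁ nx) (sym (proj₁ ny))
                 ; (suc i) → encodePoint-injective (λ i → piv (suc i)) (proj₂ nx) (proj₂ ny) e i }
  ... | false with nx | ny
  ...   | inj₁ (o , zx) | inj₁ (o' , zy) = λ
           { zero → trans o (sym o')
           ; (suc i) → encodeMasked-injective (λ i → piv (suc i)) zx zy (FinP.↑ˡ-injective _ _ _ e) i }
  ...   | inj₂ (z , n) | inj₂ (z' , m) = λ
           { zero → trans z (sym z')
           ; (suc i) → encodePoint-injective (λ i → piv (suc i)) n m (FinP.↑ʳ-injective _ _ _ e) i }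
  ...   | inj₁ _ | inj₂ _ = ⊥-elim (↑ˡ≢↑ʳ _ _ e)
  ...   | inj₂ _ | inj₁ _ = ⊥-elim (↑ˡ≢↑ʳ _ _ (P.sym e))

  encodePoint-surjective : ∀ {k} (piv : Fin k → Bool) (t : Fin (gauss1 q (falses piv))) →
    ∃ λ x → Σ (Normalised piv x) λ nx → encodePoint piv x nx ≡ t
  encodePoint-surjective {zero} piv ()
  encodePoint-surjective {suc k} piv t with piv zero
  ... | true with encodePoint-surjective (λ i → piv (suc i)) t
  ...   | y , ny , ey = (λ { zero → 0# ; (suc i) → y i }) , (refl , ny) , ey
  encodePoint-surjective {suc k} piv t | false with Fin.splitAt (q ^ falses (λ i → piv (suc i))) t in es
  ... | inj₁ a with encodeMasked-surjective (λ i → piv (suc i)) a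
  ...   | y , zy , ey = (λ { zero → 1# ; (suc i) → y i }) , inj₁ (refl , zy) ,
                        P.trans (P.cong (_↑ˡ _) ey) (FinP.splitAt⁻¹-↑ˡ es)
  encodePoint-surjective {suc k} piv t | false | inj₂ b with encodePoint-surjective (λ i → piv (suc i)) b
  ...   | y , ny , ey = (λ { zero → 0# ; (suc i) → y i }) , inj₂ (refl , ny) ,
                        P.trans (P.cong (_ ↑ʳ_) ey) (FinP.splitAt⁻¹-↑ʳ es)

  Normalised→ZeroOnMask : ∀ {k} (piv : Fin k → Bool) {x} → Normalised piv x → ZeroOnMask piv x
  Normalised→ZeroOnMask {zero} piv nx ()
  Normalised→ZeroOnMask {suc k} piv nx j e with piv zero in eq
  Normalised→ZeroOnMask {suc k} piv nx zero e | true = proj₁ nx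
  Normalised→ZeroOnMask {suc k} piv nx (suc j) e | true = Normalised→ZeroOnMask (λ i → piv (suc i)) (proj₂ nx) j e
  Normalised→ZeroOnMask {suc k} piv nx zero e | false with () ← P.trans (P.sym eq) e
  Normalised→ZeroOnMask {suc k} piv (inj₁ (_ , z)) (suc j) e | false = z j e
  Normalised→ZeroOnMask {suc k} piv (inj₂ (_ , n)) (suc j) e | false = Normalised→ZeroOnMask (λ i → piv (suc i)) n j e

  Normalised→NonZero : ∀ {k} (piv : Fin k → Bool) {x} → Normalised piv x → NonZero x
  Normalised→NonZero {zero} piv nx = ⊥-elim (lower nx)
  Normalised→NonZero {suc k} piv nx with piv zero
  ... | true with Normalised→NonZero (λ i → piv (suc i)) (proj₂ nx)
  ...   | j , h = suc j , h
  Normalised→NonZero {suc k} piv (inj₁ (o , _)) | false = zero , λ z → 1≉0 (trans (sym o) z)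
  Normalised→NonZero {suc k} piv (inj₂ (_ , n)) | false with Normalised→NonZero (λ i → piv (suc i)) n
  ...   | j , h = suc j , h

  -- The leading (first nonzero) entry of a vector, 1 for the zero vector.
  lead : ∀ {k} → Vecᶠ k → Carrier
  lead {zero} x = 1#
  lead {suc k} x with x zero ≟ 0#
  ... | yes _ = lead (tl x)
  ... | no _ = x zero

  lead≉0 : ∀ {k} (x : Vecᶠ k) → ¬ lead x ≈ 0#
  lead≉0 {zero} x = 1≉0
  lead≉0 {suc k} x with x zero ≟ 0#
  ... | yes _ = lead≉0 (tl x)
  ... | no p = p

  lead-cong : ∀ {k} {x y : Vecᶠ k} → x ≈ᵛ y → lead x ≈ lead y
  lead-cong {zero} e = refl
  lead-cong {suc k} {x} {y} e with x zero ≟ 0# | y zero ≟ 0#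
  ... | yes _ | yes _ = lead-cong (λ i → e (suc i))
  ... | no _ | no _ = e zero
  ... | yes a | no b = ⊥-elim (b (trans (sym (e zero)) a))
  ... | no a | yes b = ⊥-elim (a (trans (e zero) b))

  NonZero-tl : ∀ {k} {x : Vecᶠ (suc k)} → NonZero x → x zero ≈ 0# → NonZero (tl x)
  NonZero-tl (zero , h) z = ⊥-elim (h z)
  NonZero-tl (suc j , h) z = j , h

  lead-scale : ∀ {k} {a} (x : Vecᶠ k) → ¬ a ≈ 0# → NonZero x → lead (a ·ᵛ x) ≈ a * lead x
  lead-scale {zero} x pa (() , _)
  lead-scale {suc k} {a} x pa nz with x zero ≟ 0# | a * x zero ≟ 0#
  ... | yes z | yes _ = lead-scale (tl x) pa (NonZero-tl nz z)
  ... | no _ | no _ = refl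
  ... | yes z | no b = ⊥-elim (b (trans (*-congˡ z) (zeroʳ _)))
  ... | no z | yes b = ⊥-elim (z (cancel pa b))

  Normalised→lead : ∀ {k} (piv : Fin k → Bool) {x} → Normalised piv x → lead x ≈ 1#
  Normalised→lead {zero} piv nx = ⊥-elim (lower nx)
  Normalised→lead {suc k} piv {x} nx with piv zero | x zero ≟ 0#
  ... | true | yes _ = Normalised→lead (λ i → piv (suc i)) (proj₂ nx)
  ... | true | no a = ⊥-elim (a (proj₁ nx))
  Normalised→lead {suc k} piv (inj₁ (o , _)) | false | yes a = ⊥-elim (1≉0 (trans (sym o) a))
  Normalised→lead {suc k} piv (inj₂ (_ , n)) | false | yes a = Normalised→lead (λ i → piv (suc i)) n
  Normalised→lead {suc k} piv (inj₁ (o , _)) | false | no a = o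
  Normalised→lead {suc k} piv (inj₂ (z , _)) | false | no a = ⊥-elim (a z)

  scale-Normalised : ∀ {k} (piv : Fin k → Bool) {a} x → ZeroOnMask piv x → NonZero x → a * lead x ≈ 1# →
    Normalised piv (a ·ᵛ x)
  scale-Normalised {zero} piv x zx (() , _) e
  scale-Normalised {suc k} piv {a} x zx nz e with piv zero in eq | x zero ≟ 0#
  ... | true | yes z = trans (*-congˡ z) (zeroʳ _) ,
                       scale-Normalised (λ i → piv (suc i)) (tl x) (λ j → zx (suc j)) (NonZero-tl nz z) e
  ... | true | no z = ⊥-elim (z (zx zero eq))
  ... | false | yes z = inj₂ (trans (*-congˡ z) (zeroʳ _) ,
                        scale-Normalised (λ i → piv (suc i)) (tl x) (λ j → zx (suc j)) (NonZero-tl nz z) e)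
  ... | false | no z = inj₁ (e , λ j ej → trans (*-congˡ (zx (suc j) ej)) (zeroʳ _))

  leadInv : ∀ {k} → Vecᶠ k → Carrier
  leadInv x = inv (lead x) (lead≉0 x)

  leadInv-cong : ∀ {k} {x y : Vecᶠ k} → x ≈ᵛ y → leadInv x ≈ leadInv y
  leadInv-cong {x = x} {y} e = inv-cong (lead≉0 x) (lead≉0 y) (lead-cong e)

  leadInv-scale : ∀ {k} {a} (x : Vecᶠ k) → ¬ a ≈ 0# → NonZero x → leadInv (a ·ᵛ x) * a ≈ leadInv x
  leadInv-scale {a = a} x pa nz = inv-unique (lead≉0 x) (begin
    lead x * (leadInv (a ·ᵛ x) * a) ≈⟨ solve 3 (λ a b c → a :* (b :* c) := b :* (c :* a)) refl _ _ _ ⟩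
    leadInv (a ·ᵛ x) * (a * lead x) ≈⟨ *-congˡ (sym (lead-scale x pa nz)) ⟩
    leadInv (a ·ᵛ x) * lead (a ·ᵛ x) ≈⟨ inv-l _ _ ⟩
    1#                               ∎)

  normalise : ∀ {k} → Vecᶠ k → Vecᶠ k
  normalise x = leadInv x ·ᵛ x

  normalise-Normalised : ∀ {k} (piv : Fin k → Bool) x → ZeroOnMask piv x → NonZero x → Normalised piv (normalise x)
  normalise-Normalised piv x zx nz = scale-Normalised piv x zx nz (inv-l _ _)

  normalise-cong : ∀ {k} {x y : Vecᶠ k} → x ≈ᵛ y → normalise x ≈ᵛ normalise y
  normalise-cong e j = *-cong (leadInv-cong e) (e j)

  normalise-scale : ∀ {k} {a} (x : Vecᶠ k) → ¬ a ≈ 0# → NonZero x → normalise (a ·ᵛ x) ≈ᵛ normalise x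
  normalise-scale x pa nz j = trans (sym (*-assoc _ _ _)) (*-congʳ (leadInv-scale x pa nz))

  normalise-Normalised-id : ∀ {k} (piv : Fin k → Bool) {x} → Normalised piv x → normalise x ≈ᵛ x
  normalise-Normalised-id piv {x} nx j =
    trans (*-congʳ (sym (inv-unique (lead≉0 x) (trans (*-identityʳ _) (Normalised→lead piv nx))))) (*-identityˡ _)

  lead-normalise : ∀ {k} (x : Vecᶠ k) → x ≈ᵛ (lead x ·ᵛ normalise x)
  lead-normalise x j = sym (trans (sym (*-assoc _ _ _)) (trans (*-congʳ (inv-r _ _)) (*-identityˡ _)))

module Star {c ℓ : Level} (R : CommutativeRing c ℓ) (isField : IsField R) (q : ℕ) (hc : HasCard R q)
            (n l r : ℕ) (W : LinAlg.Mat R r (n ℕ.+ l)) (indW : LinAlg.Independent R W)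
            (meetsW : LinAlg.Ambient.MeetsETrivially R n l W) where
  open ProjectivePoints R isField q hc
  open Elimination R isField _≟_ n l
    using (V; _′; _″; ∈span-′; Reduction; reduce; module ReductionFacts)
  open Ambient n l
  open Masks using (falses)

  firstCols-independent : ∀ {s} (A : Mat s (n ℕ.+ l)) → Independent A → MeetsETrivially A →
    Independent (firstCols A)
  firstCols-independent A ind meets cs h = ind cs (meets (lincomb cs A) (cs , ≈ᵛ-refl) h)

  D : Reduction W
  D = reduce W (firstCols-independent W indW meetsW)
  open Reduction D
  open ReductionFacts D

  Vertex : Set (c ⊔ ℓ)
  Vertex = CV {suc r} W

  module _ (P : Vertex) where
    rows : Mat (suc r) (n ℕ.+ l)
    rows = proj₁ (proj₁ P)

    rows-independent : Independent rows
    rows-independent = proj₁ (proj₂ (proj₁ P))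

    rows-meet-E : MeetsETrivially rows
    rows-meet-E = proj₂ (proj₂ (proj₁ P))

    W⊆ : ∀ v → v ∈span W → v ∈span rows
    W⊆ = proj₂ P

  -- red maps a vertex into itself, since v - red v ∈ W ⊆ P.
  red-stays : ∀ P {x} → x ∈span rows P → red x ∈span rows P
  red-stays P {x} h = ∈span-cong {A = rows P} (λ j → solve 2 (λ a b → a :- (a :- b) := b) refl _ _)
                        (∈span-- {A = rows P} h (W⊆ P _ (red-diff x)))

  -- Since P ∩ E = 0, a nonzero reduced vector of P is nonzero in its first part.
  red′-nonzero : ∀ P {x} → x ∈span rows P → NonZero (red x) → NonZero (red x ′)
  red′-nonzero P {x} h nz with zero-or-nonzero (red x ′)
  ... | inj₂ nz′ = nz′
  ... | inj₁ z = ⊥-elim (proj₂ nz (rows-meet-E P (red x) (red-stays P h) z (proj₁ nz)))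

  NonZero′→NonZero : ∀ {x} → NonZero (red x ′) → NonZero (red x)
  NonZero′→NonZero (j , h) = j ↑ˡ l , h

  too-many : ∀ P (A : Mat (suc (suc r)) (n ℕ.+ l)) → Independent A → (∀ i → A i ∈span rows P) → ⊥
  too-many P A ind inP = ℕP.<-irrefl P.refl (steinitz A (rows P) ind inP)

  infixr 5 _◂_
  _◂_ : ∀ {s} → V → Mat s (n ℕ.+ l) → Mat (suc s) (n ℕ.+ l)
  (x ◂ A) zero = x
  (x ◂ A) (suc i) = A i

  leading-coefficient-zero : ∀ {s x} (A : Mat s (n ℕ.+ l)) cs j → ¬ red x j ≈ 0# →
    red (lincomb (λ i → cs (suc i)) A) j ≈ 0# → red (lincomb cs (x ◂ A)) j ≈ 0# → cs zero ≈ 0#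
  leading-coefficient-zero {x = x} A cs j rxj≉0 rest≈0 all≈0 = cancel rxj≉0 (trans (*-comm _ _) (begin
    cs zero * red x j                                                ≈⟨ sym (+-identityʳ _) ⟩
    cs zero * red x j + 0#                                           ≈⟨ +-congˡ (sym rest≈0) ⟩
    cs zero * red x j + red (lincomb (λ i → cs (suc i)) A) j         ≈⟨ sym (red-linear (cs zero) x _ j) ⟩
    red (lincomb cs (x ◂ A)) j                                       ≈⟨ all≈0 ⟩
    0#                                                               ∎))

  drop-leading : ∀ {s x} {A : Mat s (n ℕ.+ l)} cs → cs zero ≈ 0# →
    lincomb cs (x ◂ A) ≈ᵛ lincomb (λ i → cs (suc i)) A
  drop-leading cs c₀≈0 j = trans (+-congʳ (trans (*-congʳ c₀≈0) (zeroˡ _))) (+-identityˡ _)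

  ◂-independent : ∀ {s} x (A : Mat s (n ℕ.+ l)) → Independent A →
    (∀ cs → lincomb cs (x ◂ A) ≈ᵛ 0ᵛ → cs zero ≈ 0#) → Independent (x ◂ A)
  ◂-independent x A ind leading cs h zero = leading cs h
  ◂-independent x A ind leading cs h (suc i) =
    ind (λ i → cs (suc i)) (≈ᵛ-trans (≈ᵛ-sym (drop-leading cs (leading cs h))) h) i

  combination-zero⇒red-zero : ∀ {s} (A : Mat s (n ℕ.+ l)) cs → lincomb cs A ≈ᵛ 0ᵛ → red (lincomb cs A) ≈ᵛ 0ᵛ
  combination-zero⇒red-zero A cs h = ≈ᵛ-trans (red-cong h) red-0

  row-outside-W : ∀ P → ∃ λ i → NonZero (red (rows P i))
  row-outside-W P with FinP.any? (λ i → nonzero? (red (rows P i)))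
    where
    nonzero? : ∀ v → Dec (NonZero v)
    nonzero? v with zero-or-nonzero v
    ... | inj₁ z = no λ (j , h) → h (z j)
    ... | inj₂ nz = yes nz
  ... | yes found = found
  ... | no none = ⊥-elim (ℕP.<-irrefl P.refl (steinitz (rows P) W (rows-independent P) rows-in-W))
    where
    rows-in-W : ∀ i → rows P i ∈span W
    rows-in-W i with zero-or-nonzero (red (rows P i))
    ... | inj₁ z = kernel-span z
    ... | inj₂ nz = ⊥-elim (none (i , nz))

  -- A chosen vector of P outside W: P = W + ⟨generator P⟩.
  generator : Vertex → V
  generator P = rows P (proj₁ (row-outside-W P))

  generator-∈ : ∀ P → generator P ∈span rows P
  generator-∈ P = ∈span-row (rows P) (proj₁ (row-outside-W P))

  generator-red′ : ∀ P → NonZero (red (generator P) ′)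
  generator-red′ P = red′-nonzero P (generator-∈ P) (proj₂ (row-outside-W P))

  -- red maps a vertex onto a line: any two reductions of vectors of P are
  -- proportional.  Otherwise x, y - a x and W would be r + 2 independent
  -- vectors of P.
  proportional : ∀ P {x y} → x ∈span rows P → y ∈span rows P → NonZero (red x) →
    ∃ λ a → red y ≈ᵛ (a ·ᵛ red x)
  proportional P {x} {y} hx hy (j , rxj≉0) = a , λ t → begin
      red y t                               ≈⟨ solve 2 (λ a b → a := (a :- b) :+ b) refl _ _ ⟩
      (red y t - a * red x t) + a * red x t ≈⟨ +-congʳ (trans (sym (red-z t)) (red-z≈0 t)) ⟩
      0# + a * red x t                      ≈⟨ +-identityˡ _ ⟩
      a * red x t                           ∎
    where
    a = red y j * inv (red x j) rxj≉0
    z = y -ᵛ a ·ᵛ x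
    red-z : ∀ t → red z t ≈ red y t - a * red x t
    red-z t = trans (red-- y (a ·ᵛ x) t) (+-congˡ (-‿cong (red-· a x t)))
    red-z-j : red z j ≈ 0#
    red-z-j = trans (red-z j) (trans (+-congˡ (-‿cong (trans (*-assoc _ _ _) (trans (*-congˡ (inv-l _ rxj≉0)) (*-identityʳ _)))))
                                     (-‿inverseʳ _))
    red-z≈0 : red z ≈ᵛ 0ᵛ
    red-z≈0 with zero-or-nonzero (red z)
    ... | inj₁ z≈0 = z≈0
    ... | inj₂ (k , rzk≉0) = ⊥-elim (too-many P (x ◂ z ◂ W) independent inP)
      where
      independent-zW : Independent (z ◂ W)
      independent-zW = ◂-independent z W indW λ cs h →
        leading-coefficient-zero W cs k rzk≉0 (red-span (_ , ≈ᵛ-refl) k) (combination-zero⇒red-zero (z ◂ W) cs h k)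
      independent : Independent (x ◂ z ◂ W)
      independent = ◂-independent x (z ◂ W) independent-zW λ cs h →
        leading-coefficient-zero (z ◂ W) cs j rxj≉0
          (trans (red-linear (cs (suc zero)) z _ j)
                 (trans (+-cong (trans (*-congˡ red-z-j) (zeroʳ _)) (red-span (_ , ≈ᵛ-refl) j)) (+-identityʳ 0#)))
          (combination-zero⇒red-zero (x ◂ z ◂ W) cs h j)
      inP : ∀ i → (x ◂ z ◂ W) i ∈span rows P
      inP zero = hx
      inP (suc zero) = ∈span-- {A = rows P} hy (∈span-· {A = rows P} a hx)
      inP (suc (suc i)) = W⊆ P _ (∈span-row W i)

  -- The number and size of the parts: r pivots leave falses piv = n - r
  -- free coordinates among the first n.
  parts partSize : ℕ
  parts = gauss1 q (falses piv)
  partSize = q ^ l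

  parts-count : parts ≡ gauss1 q (n ∸ r)
  parts-count = P.cong (gauss1 q) (Masks.falses-complement piv piv-count)

  -- The part of x is the point of (red x)′; its position in the part is
  -- red x ″ scaled by the factor that normalises (red x)′.
  code : (x : V) → NonZero (red x ′) → KVertex parts partSize
  code x h = encodePoint piv (normalise (red x ′)) (normalise-Normalised piv (red x ′) (red-piv x) h) ,
             encodeVec (leadInv (red x ′) ·ᵛ (red x ″))

  code-proportional : ∀ {x y} hx hy a → red y ≈ᵛ (a ·ᵛ red x) → code x hx ≡ code y hy
  code-proportional {x} {y} hx hy a e = P.cong₂ _,_ (encodePoint-cong piv same-point _ _) (encodeVec-cong same-position)
    where
    a≉0 : ¬ a ≈ 0#
    a≉0 a≈0 = proj₂ hy (trans (e _) (trans (*-congʳ a≈0) (zeroˡ _)))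
    e′ : (red y ′) ≈ᵛ (a ·ᵛ (red x ′))
    e′ j = e (j ↑ˡ l)
    same-point : normalise (red x ′) ≈ᵛ normalise (red y ′)
    same-point = ≈ᵛ-sym (≈ᵛ-trans (normalise-cong e′) (normalise-scale (red x ′) a≉0 hx))
    same-position : (leadInv (red x ′) ·ᵛ (red x ″)) ≈ᵛ (leadInv (red y ′) ·ᵛ (red y ″))
    same-position j = begin
      leadInv (red x ′) * red x (n ↑ʳ j)              ≈⟨ *-congʳ (sym (leadInv-scale (red x ′) a≉0 hx)) ⟩
      (leadInv (a ·ᵛ (red x ′)) * a) * red x (n ↑ʳ j) ≈⟨ *-assoc _ _ _ ⟩
      leadInv (a ·ᵛ (red x ′)) * (a * red x (n ↑ʳ j)) ≈⟨ *-cong (leadInv-cong (≈ᵛ-sym e′)) (sym (e (n ↑ʳ j))) ⟩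
      leadInv (red y ′) * red y (n ↑ʳ j)              ∎

  coordinate-split : ∀ (k : Fin (n ℕ.+ l)) → (∃ λ j → j ↑ˡ l ≡ k) ⊎ (∃ λ j → n ↑ʳ j ≡ k)
  coordinate-split k with Fin.splitAt n k in e
  ... | inj₁ j = inj₁ (j , FinP.splitAt⁻¹-↑ˡ e)
  ... | inj₂ j = inj₂ (j , FinP.splitAt⁻¹-↑ʳ e)

  same-point⇒proportional′ : ∀ x y → normalise (red x ′) ≈ᵛ normalise (red y ′) →
    ∀ j → red x (j ↑ˡ l) ≈ (lead (red x ′) * leadInv (red y ′)) * red y (j ↑ˡ l)
  same-point⇒proportional′ x y e j =
    trans (lead-normalise (red x ′) j) (trans (*-congˡ (e j)) (sym (*-assoc _ _ _)))

  code-injective : ∀ {x y} hx hy → code x hx ≡ code y hy → ∃ λ a → red x ≈ᵛ (a ·ᵛ red y)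
  code-injective {x} {y} hx hy e = lead (red x ′) * leadInv (red y ′) , same-line
    where
    same-point = encodePoint-injective piv _ _ (P.cong proj₁ e)
    same-position = encodeVec-injective (P.cong proj₂ e)
    same-line : ∀ k → red x k ≈ (lead (red x ′) * leadInv (red y ′)) * red y k
    same-line k with coordinate-split k
    ... | inj₁ (j , P.refl) = same-point⇒proportional′ x y same-point j
    ... | inj₂ (j , P.refl) = begin
      red x (n ↑ʳ j)                                           ≈⟨ sym (trans (*-congʳ (inv-r _ _)) (*-identityˡ _)) ⟩
      (lead (red x ′) * leadInv (red x ′)) * red x (n ↑ʳ j)      ≈⟨ *-assoc _ _ _ ⟩
      lead (red x ′) * (leadInv (red x ′) * red x (n ↑ʳ j))      ≈⟨ *-congˡ (same-position j) ⟩
      lead (red x ′) * (leadInv (red y ′) * red y (n ↑ʳ j))      ≈⟨ sym (*-assoc _ _ _) ⟩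
      (lead (red x ′) * leadInv (red y ′)) * red y (n ↑ʳ j)      ∎

  f : Vertex → KVertex parts partSize
  f P = code (generator P) (generator-red′ P)

  f-code : ∀ P {x} (x∈P : x ∈span rows P) (hx : NonZero (red x ′)) → f P ≡ code x hx
  f-code P x∈P hx = code-proportional _ hx (proj₁ x∝generator) (proj₂ x∝generator)
    where x∝generator = proportional P (generator-∈ P) x∈P (NonZero′→NonZero (generator-red′ P))

  f-resp : ∀ P Q → CSame P Q → f P ≡ f Q
  f-resp P Q P≡Q = f-code P (proj₂ (P≡Q (generator Q)) (generator-∈ Q)) (generator-red′ Q)

  -- v ∈ P is (v - red v) + (a multiple of red (generator Q)), both in Q.
  contained : ∀ P Q → f P ≡ f Q → ∀ v → v ∈span rows P → v ∈span rows Q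
  contained P Q e v v∈P = ∈span-cong {A = rows Q} decomposition
    (∈span-+ {A = rows Q} (W⊆ Q _ (red-diff v)) (∈span-· {A = rows Q} (d * k) (red-stays Q (generator-∈ Q))))
    where
    -- red (generator P) = k · red (generator Q) and red v = d · red (generator P)
    k = proj₁ (code-injective _ _ e)
    e₁ = proj₂ (code-injective _ _ e)
    d = proj₁ (proportional P (generator-∈ P) v∈P (NonZero′→NonZero (generator-red′ P)))
    e₂ = proj₂ (proportional P (generator-∈ P) v∈P (NonZero′→NonZero (generator-red′ P)))
    decomposition : ((v -ᵛ red v) +ᵛ (d * k) ·ᵛ red (generator Q)) ≈ᵛ v
    decomposition j = begin
      (v j - red v j) + (d * k) * red (generator Q) j     ≈⟨ +-congʳ (+-congˡ (-‿cong (trans (e₂ j) (*-congˡ (e₁ j))))) ⟩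
      (v j - d * (k * red (generator Q) j)) + (d * k) * red (generator Q) j
        ≈⟨ solve 4 (λ v d c t → (v :- d :* (c :* t)) :+ (d :* c) :* t := v) refl _ _ _ _ ⟩
      v j                                                 ∎

  f-inj : ∀ P Q → f P ≡ f Q → CSame P Q
  f-inj P Q e v = contained P Q e v , contained Q P (P.sym e) v

  -- The vertex W + ⟨z⟩ for z = (z₁ , z₂) with z₁ normalised: its code is
  -- (the point z₁ , z₂).
  module Realise (z₁ : Vecᶠ n) (z₁-normalised : Normalised piv z₁) (z₂ : Vecᶠ l) where
    z : V
    z k = [ z₁ , z₂ ]′ (Fin.splitAt n k)

    z′ : (z ′) ≈ᵛ z₁
    z′ j = reflexive (P.cong [ z₁ , z₂ ]′ (FinP.splitAt-↑ˡ n j l))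

    z″ : (z ″) ≈ᵛ z₂
    z″ j = reflexive (P.cong [ z₁ , z₂ ]′ (FinP.splitAt-↑ʳ n l j))

    red-z : red z ≈ᵛ z
    red-z = red-fix z (λ j e → trans (z′ j) (Normalised→ZeroOnMask piv z₁-normalised j e))

    j₀ = proj₁ (Normalised→NonZero piv z₁-normalised)

    red-z-j₀ : ¬ red z (j₀ ↑ˡ l) ≈ 0#
    red-z-j₀ e = proj₂ (Normalised→NonZero piv z₁-normalised) (trans (sym (trans (red-z _) (z′ j₀))) e)

    leading-zero : ∀ cs → red (lincomb cs (z ◂ W)) (j₀ ↑ˡ l) ≈ 0# → cs zero ≈ 0#
    leading-zero cs = leading-coefficient-zero W cs (j₀ ↑ˡ l) red-z-j₀ (red-span (_ , ≈ᵛ-refl) _)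

    independent : Independent (z ◂ W)
    independent = ◂-independent z W indW λ cs h → leading-zero cs (combination-zero⇒red-zero (z ◂ W) cs h _)

    meets-E : MeetsETrivially (z ◂ W)
    meets-E v (cs , v≈) v∈E = ≈ᵛ-trans v≈ (≈ᵛ-trans (drop-leading {x = z} {W} cs c₀≈0) (meetsW _ (_ , ≈ᵛ-refl) rest∈E))
      where
      c₀≈0 : cs zero ≈ 0#
      c₀≈0 = leading-zero cs (trans (sym (red-cong v≈ _)) (trans (red-E v∈E _) (v∈E j₀)))
      rest∈E : InE (lincomb (λ i → cs (suc i)) W)
      rest∈E j = trans (sym (drop-leading {x = z} {W} cs c₀≈0 _)) (trans (sym (v≈ _)) (v∈E j))

    W⊆zW : ∀ v → v ∈span W → v ∈span (z ◂ W)
    W⊆zW v (cs , h) = cs′ , λ k → trans (h k) (sym (drop-leading {x = z} {W} cs′ refl k))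
      where
      cs′ : Fin (suc r) → Carrier
      cs′ zero = 0#
      cs′ (suc i) = cs i

    vertex : Vertex
    vertex = ((z ◂ W) , independent , meets-E) , W⊆zW

    vertex-code : f vertex ≡ (encodePoint piv z₁ z₁-normalised , encodeVec z₂)
    vertex-code = P.trans (f-code vertex (∈span-row (z ◂ W) zero) hz) (P.cong₂ _,_ point position)
      where
      hz : NonZero (red z ′)
      hz = j₀ , red-z-j₀
      red-z′ : (red z ′) ≈ᵛ z₁
      red-z′ j = trans (red-z _) (z′ j)
      point : _ ≡ encodePoint piv z₁ z₁-normalised
      point = encodePoint-cong piv (≈ᵛ-trans (normalise-cong red-z′) (normalise-Normalised-id piv z₁-normalised)) _ _
      leadInv≈1 : leadInv (red z ′) ≈ 1#
      leadInv≈1 = trans (leadInv-cong red-z′)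
                        (sym (inv-unique (lead≉0 z₁) (trans (*-identityʳ _) (Normalised→lead piv z₁-normalised))))
      position : encodeVec (leadInv (red z ′) ·ᵛ (red z ″)) ≡ encodeVec z₂
      position = encodeVec-cong (λ j → trans (*-cong leadInv≈1 (trans (red-z _) (z″ j))) (*-identityˡ _))

  f-surj : ∀ t → ∃ λ P → f P ≡ t
  f-surj (t₁ , t₂) with encodePoint-surjective piv t₁ | encodeVec-surjective {l} t₂
  ... | z₁ , nz₁ , e₁ | z₂ , e₂ = Realise.vertex z₁ nz₁ z₂ ,
                                    P.trans (Realise.vertex-code z₁ nz₁ z₂) (P.cong₂ _,_ e₁ e₂)

  -- Same part: the first parts of P lie in Q′, since red (generator P)′ and
  -- red (generator Q)′ are proportional.
  same-part⇒P′⊆Q′ : ∀ P Q → proj₁ (f P) ≡ proj₁ (f Q) → ∀ i → (rows P i ′) ∈span firstCols (rows Q)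
  same-part⇒P′⊆Q′ P Q e i = ∈span-cong {A = firstCols (rows Q)} decomposition (∈span-′ {B = rows Q}
    (∈span-+ {A = rows Q} (W⊆ Q _ (red-diff (rows P i)))
                          (∈span-· {A = rows Q} (d * scale) (red-stays Q (generator-∈ Q)))))
    where
    x = generator P
    y = generator Q
    -- red (rows P i) = d · red x, and (red x)′ = scale · (red y)′
    d = proj₁ (proportional P (generator-∈ P) (∈span-row (rows P) i) (NonZero′→NonZero (generator-red′ P)))
    e-d = proj₂ (proportional P (generator-∈ P) (∈span-row (rows P) i) (NonZero′→NonZero (generator-red′ P)))
    scale = lead (red x ′) * leadInv (red y ′)
    x′∝y′ : ∀ j → red x (j ↑ˡ l) ≈ scale * red y (j ↑ˡ l)
    x′∝y′ = same-point⇒proportional′ x y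
              (encodePoint-injective piv (normalise-Normalised piv (red x ′) (red-piv x) (generator-red′ P))
                                         (normalise-Normalised piv (red y ′) (red-piv y) (generator-red′ Q)) e)
    decomposition : (((rows P i -ᵛ red (rows P i)) +ᵛ (d * scale) ·ᵛ red y) ′) ≈ᵛ (rows P i ′)
    decomposition j = begin
      (rows P i (j ↑ˡ l) - red (rows P i) (j ↑ˡ l)) + (d * scale) * red y (j ↑ˡ l)
        ≈⟨ +-congʳ (+-congˡ (-‿cong (trans (e-d _) (*-congˡ (x′∝y′ j))))) ⟩
      (rows P i (j ↑ˡ l) - d * (scale * red y (j ↑ˡ l))) + (d * scale) * red y (j ↑ˡ l)
        ≈⟨ solve 4 (λ a d c t → (a :- d :* (c :* t)) :+ (d :* c) :* t := a) refl _ _ _ _ ⟩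
      rows P i (j ↑ˡ l) ∎

  -- ... so P′ ∩ Q′ = P′ would need r + 1 independent vectors in an r-space.
  adj→ : ∀ P Q → CAdj P Q → KAdj (f P) (f Q)
  adj→ P Q ((B , _ , B-spans) , _) e =
    ℕP.<-irrefl P.refl (steinitz (firstCols (rows P)) B independent rows-in)
    where
    independent = firstCols-independent (rows P) (rows-independent P) (rows-meet-E P)
    rows-in : ∀ i → firstCols (rows P) i ∈span B
    rows-in i = proj₂ (B-spans _) (∈span-row (firstCols (rows P)) i , same-part⇒P′⊆Q′ P Q e i)

  -- Different parts: if a ∈ P and b ∈ Q reduce to the same first part,
  -- then a ∈ W, for otherwise red a and red b would give the same point.
  meet-in-W : ∀ P Q → KAdj (f P) (f Q) → ∀ {a b} → a ∈span rows P → b ∈span rows Q →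
    (red a ′) ≈ᵛ (red b ′) → a ∈span W
  meet-in-W P Q ne {a} {b} ha hb e = by-cases (α ≟ 0#)
    where
    x = generator P
    y = generator Q
    hx = generator-red′ P
    hy = generator-red′ Q
    -- red a = α · red x and red b = β · red y
    α = proj₁ (proportional P (generator-∈ P) ha (NonZero′→NonZero hx))
    eα = proj₂ (proportional P (generator-∈ P) ha (NonZero′→NonZero hx))
    β = proj₁ (proportional Q (generator-∈ Q) hb (NonZero′→NonZero hy))
    eβ = proj₂ (proportional Q (generator-∈ Q) hb (NonZero′→NonZero hy))
    related : (α ·ᵛ (red x ′)) ≈ᵛ (β ·ᵛ (red y ′))
    related j = trans (sym (eα _)) (trans (e j) (eβ _))
    same-point : ¬ α ≈ 0# → normalise (red x ′) ≈ᵛ normalise (red y ′)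
    same-point α≉0 = ≈ᵛ-trans (≈ᵛ-sym (normalise-scale (red x ′) α≉0 hx))
                       (≈ᵛ-trans (normalise-cong related) (normalise-scale (red y ′) β≉0 hy))
      where
      β≉0 : ¬ β ≈ 0#
      β≉0 β≈0 = proj₂ hx (cancel α≉0 (trans (related (proj₁ hx)) (trans (*-congʳ β≈0) (zeroˡ _))))
    by-cases : Dec (α ≈ 0#) → a ∈span W
    by-cases (yes α≈0) = kernel-span (λ k → trans (eα k) (trans (*-congʳ α≈0) (zeroˡ _)))
    by-cases (no α≉0) = ⊥-elim (ne (encodePoint-cong piv (same-point α≉0)
      (normalise-Normalised piv (red x ′) (red-piv x) hx) (normalise-Normalised piv (red y ′) (red-piv y) hy)))

  -- Hence P′ ∩ Q′ = W′ and P ∩ Q = W, both of dimension r.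
  adj← : ∀ P Q → KAdj (f P) (f Q) → CAdj P Q
  adj← P Q ne = (firstCols W , firstCols-independent W indW meetsW , λ v → W′⊆ v , ⊆W′ v)
              , (W , indW , λ v → (λ h → W⊆ P v h , W⊆ Q v h) , ⊆W v)
    where
    W′⊆ : ∀ v → v ∈span firstCols W → (v ∈span firstCols (rows P)) × (v ∈span firstCols (rows Q))
    W′⊆ v (cs , h) = ∈span-cong {A = firstCols (rows P)} (≈ᵛ-sym h) (∈span-′ {B = rows P} (W⊆ P _ (cs , ≈ᵛ-refl))) ,
                     ∈span-cong {A = firstCols (rows Q)} (≈ᵛ-sym h) (∈span-′ {B = rows Q} (W⊆ Q _ (cs , ≈ᵛ-refl)))
    ⊆W′ : ∀ v → (v ∈span firstCols (rows P)) × (v ∈span firstCols (rows Q)) → v ∈span firstCols W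
    ⊆W′ v ((cs , ha) , (ds , hb)) = ∈span-cong {A = firstCols W} (≈ᵛ-sym ha) (∈span-′ {B = W}
      (meet-in-W P Q ne (cs , ≈ᵛ-refl) (ds , ≈ᵛ-refl) (red′-cong (λ j → trans (sym (ha j)) (hb j)))))
    ⊆W : ∀ v → (v ∈span rows P) × (v ∈span rows Q) → v ∈span W
    ⊆W v (ha , hb) = meet-in-W P Q ne ha hb (λ j → refl)

  iso : IsoToK Vertex CSame CAdj parts partSize
  iso = record { f = f ; f-resp = f-resp ; f-inj = f-inj ; f-surj = f-surj ; adj→ = adj→ ; adj← = adj← }

∸-suc : ∀ {k n} → suc k ℕ.≤ n → n ∸ k ≡ n ∸ suc k ℕ.+ 1
∸-suc {k} {n} k<n = P.trans (ℕP.+-∸-assoc 1 k<n) (ℕP.+-comm 1 (n ∸ suc k))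

lemma2p4 : {c ℓ : Level} (F : CommutativeRing c ℓ) → IsField F →
    (q : ℕ) → IsPrimePower q → HasCard F q →
    (n l m : ℕ) → 1 < m → m < n ∸ 1 → 0 < l →
    (W : LinAlg.Mat F (m ∸ 1) (n Data.Nat.+ l)) →
    LinAlg.Independent F W → LinAlg.Ambient.MeetsETrivially F n l W →
    IsoToK (LinAlg.Ambient.CV F n l {m} W) (LinAlg.Ambient.CSame F n l)
           (LinAlg.Ambient.CAdj F n l) (gauss1 q (n ∸ m Data.Nat.+ 1)) (q ^ l)
lemma2p4 F isField q _ hc n l (suc (suc r)) (s≤s (s≤s _)) m<n-1 _ W indW meetsW =
  P.subst (λ a → IsoToK (LinAlg.Ambient.CV F n l {suc (suc r)} W) (LinAlg.Ambient.CSame F n l {W = W})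
                        (LinAlg.Ambient.CAdj F n l {W = W}) a (q ^ l))
          (P.trans S.parts-count (P.cong (gauss1 q) (∸-suc m≤n)))
          S.iso
  where
  module S = Star F isField q hc n l (suc r) W indW meetsW
  m≤n : suc (suc r) ℕ.≤ n
  m≤n = ℕP.<⇒≤ (ℕP.<-≤-trans m<n-1 (ℕP.m∸n≤m n 1))
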